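{- A graph $G$ with no isolated vertices is critically $2K_2$-exist if and only if $G$ is isomorphic to one of the following: (1) $C_6$; (2) $C_6$ with vertices $x_0,\dots,x_5$ in cyclic order plus the chord $x_0x_2$; (3) $C_6$ with vertices $x_0,\dots,x_5$ in cyclic order plus the chords $x_0x_2$ and $x_3x_5$; (4) the graph with vertex set $\{r,s,t,u,v,w,x\}$ and edges $rs,tu,rv,uv,rw,tw,sx,tx,ux$; (5) for integers $a,b,c\ge 0$: vertices $r,s,t,u$ with edges $rs,tu$, plus an independent set $W\cup X\cup Y$ with $|W|=a,|X|=b,|Y|=c$, each vertex of $W$ adjacent exactly to $s,t,u$, of $X$ exactly to $r,t,u$, of $Y$ exactly to $r,s,t,u$; (6) for integers $a,b,c,d\ge 0$: vertices $r,s,t,u$ with edges $rs,tu$, plus an independent set $W\cup X\cup Y\cup Z$ with $|W|=a,|X|=b,|Y|=c,|Z|=d$, each vertex of $W$ adjacent exactly to $s,t$, of $X$ exactly to $s,u$, of $Y$ exactly to $s,t,u$, of $Z$ exactly to $r,s,t,u$.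
   Context: All graphs are finite and simple; $2K_2$ denotes two disjoint edges. For an edge $e=uv$, the contraction $G/e$ is obtained by deleting $u,v$ and adding a new vertex adjacent to every vertex of $(N(u)\cup N(v))\setminus\{u,v\}$. $G$ is critically $2K_2$-exist if $G$ has an induced $2K_2$ but $G/e$ has none for every $e\in E(G)$. -}

module Defs where

open import Data.Bool using (Bool; true; false; _∨_; _∧_; not)
open import Data.Bool.Properties using (∨-comm)
open import Data.Nat using (ℕ)
open import Data.Fin using (Fin)
open import Data.Maybe using (Maybe; just; nothing)
open import Data.Product using (Σ; _×_; _,_; ∃-syntax)
open import Data.Sum using (_⊎_)
open import Relation.Binary.PropositionalEquality using (_≡_; _≢_; refl)
open import Function.Bundles using (_↔_; Inverse)
open import Relation.Nullary using (¬_)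

record Graph (V : Set) : Set where
  field
    adj   : V → V → Bool
    sym   : ∀ x y → adj x y ≡ adj y x
    irref : ∀ x → adj x x ≡ false
open Graph public

Adj : ∀ {V} → Graph V → V → V → Set
Adj G x y = adj G x y ≡ true

FinGraph : ℕ → Set
FinGraph n = Graph (Fin n)

NoIsolated : ∀ {V} → Graph V → Set
NoIsolated {V} G = ∀ x → ∃[ y ] Adj G x y

-- G contains an induced 2K2: distinct vertices a,b,c,d with ab, cd edges
-- and no edge among ac, ad, bc, bd.  (a ≠ b, c ≠ d follow from irreflexivity.)
Has2K2 : ∀ {V} → Graph V → Set
Has2K2 {V} G = Σ V λ a → Σ V λ b → Σ V λ c → Σ V λ d →
  Adj G a b × Adj G c d ×
  a ≢ c × a ≢ d × b ≢ c × b ≢ d ×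
  adj G a c ≡ false × adj G a d ≡ false ×
  adj G b c ≡ false × adj G b d ≡ false

-- Contraction G/e of the edge e = uv: delete u, v and add a new vertex
-- (nothing) adjacent to every vertex of (N(u) ∪ N(v)) \ {u,v}.
ContrV : ∀ {V} → V → V → Set
ContrV {V} u v = Maybe (Σ V λ x → x ≢ u × x ≢ v)

contract : ∀ {V} → Graph V → (u v : V) → Graph (ContrV u v)
contract {V} G u v = record { adj = a ; sym = s ; irref = i }
  where
  a : ContrV u v → ContrV u v → Bool
  a nothing nothing = false
  a nothing (just (y , _)) = adj G u y ∨ adj G v y
  a (just (x , _)) nothing = adj G u x ∨ adj G v x
  a (just (x , _)) (just (y , _)) = adj G x y
  s : ∀ x y → a x y ≡ a y x
  s nothing nothing = refl
  s nothing (just _) = refl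
  s (just _) nothing = refl
  s (just (x , _)) (just (y , _)) = sym G x y
  i : ∀ x → a x x ≡ false
  i nothing = refl
  i (just (x , _)) = irref G x

Critically2K2Exist : ∀ {V} → Graph V → Set
Critically2K2Exist {V} G =
  Has2K2 G × (∀ u v → Adj G u v → ¬ Has2K2 (contract G u v))

_≅_ : ∀ {V W} → Graph V → Graph W → Set
_≅_ {V} {W} G H = Σ (V ↔ W) λ f →
  ∀ x y → adj H (Inverse.to f x) (Inverse.to f y) ≡ adj G x y

fromEdges : ∀ {V} (e : V → V → Bool) → (∀ x → e x x ≡ false) → Graph V
fromEdges {V} e irr = record { adj = a ; sym = s ; irref = i }
  where
  a : V → V → Bool
  a x y = e x y ∨ e y x
  s : ∀ x y → a x y ≡ a y x
  s x y = ∨-comm (e x y) (e y x)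
  i : ∀ x → a x x ≡ false
  i x with e x x | irr x
  ... | false | refl = refl

data X6 : Set where
  x0 x1 x2 x3 x4 x5 : X6

c6e : X6 → X6 → Bool
c6e x0 x1 = true
c6e x1 x2 = true
c6e x2 x3 = true
c6e x3 x4 = true
c6e x4 x5 = true
c6e x5 x0 = true
c6e _  _  = false

C6 : Graph X6
C6 = fromEdges c6e irr
  where
  irr : ∀ x → c6e x x ≡ false
  irr x0 = refl
  irr x1 = refl
  irr x2 = refl
  irr x3 = refl
  irr x4 = refl
  irr x5 = refl

c6e₁ : X6 → X6 → Bool
c6e₁ x0 x2 = true
c6e₁ x y = c6e x y

C6+1 : Graph X6
C6+1 = fromEdges c6e₁ irr
  where
  irr : ∀ x → c6e₁ x x ≡ false
  irr x0 = refl
  irr x1 = refl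
  irr x2 = refl
  irr x3 = refl
  irr x4 = refl
  irr x5 = refl

c6e₂ : X6 → X6 → Bool
c6e₂ x0 x2 = true
c6e₂ x3 x5 = true
c6e₂ x y = c6e x y

C6+2 : Graph X6
C6+2 = fromEdges c6e₂ irr
  where
  irr : ∀ x → c6e₂ x x ≡ false
  irr x0 = refl
  irr x1 = refl
  irr x2 = refl
  irr x3 = refl
  irr x4 = refl
  irr x5 = refl

data V7 : Set where
  r s t u v w x : V7

g4e : V7 → V7 → Bool
g4e r s = true
g4e t u = true
g4e r v = true
g4e u v = true
g4e r w = true
g4e t w = true
g4e s x = true
g4e t x = true
g4e u x = true
g4e _ _ = false

G4 : Graph V7
G4 = fromEdges g4e irr
  where
  irr : ∀ y → g4e y y ≡ false
  irr r = refl
  irr s = refl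
  irr t = refl
  irr u = refl
  irr v = refl
  irr w = refl
  irr x = refl

data V5 (a b c : ℕ) : Set where
  r s t u : V5 a b c
  W : Fin a → V5 a b c
  X : Fin b → V5 a b c
  Y : Fin c → V5 a b c

g5e : ∀ {a b c} → V5 a b c → V5 a b c → Bool
g5e r s = true
g5e t u = true
g5e (W _) s = true
g5e (W _) t = true
g5e (W _) u = true
g5e (X _) r = true
g5e (X _) t = true
g5e (X _) u = true
g5e (Y _) r = true
g5e (Y _) s = true
g5e (Y _) t = true
g5e (Y _) u = true
g5e _ _ = false

G5 : (a b c : ℕ) → Graph (V5 a b c)
G5 a b c = fromEdges g5e irr
  where
  irr : ∀ y → g5e y y ≡ false
  irr r = refl
  irr s = refl
  irr t = refl
  irr u = refl
  irr (W _) = refl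
  irr (X _) = refl
  irr (Y _) = refl

data V6 (a b c d : ℕ) : Set where
  r s t u : V6 a b c d
  W : Fin a → V6 a b c d
  X : Fin b → V6 a b c d
  Y : Fin c → V6 a b c d
  Z : Fin d → V6 a b c d

g6e : ∀ {a b c d} → V6 a b c d → V6 a b c d → Bool
g6e r s = true
g6e t u = true
g6e (W _) s = true
g6e (W _) t = true
g6e (X _) s = true
g6e (X _) u = true
g6e (Y _) s = true
g6e (Y _) t = true
g6e (Y _) u = true
g6e (Z _) r = true
g6e (Z _) s = true
g6e (Z _) t = true
g6e (Z _) u = true
g6e _ _ = false

G6 : (a b c d : ℕ) → Graph (V6 a b c d)
G6 a b c d = fromEdges g6e irr
  where
  irr : ∀ y → g6e y y ≡ false
  irr r = refl
  irr s = refl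
  irr t = refl
  irr u = refl
  irr (W _) = refl
  irr (X _) = refl
  irr (Y _) = refl
  irr (Z _) = refl

InList : ∀ {V} → Graph V → Set
InList G =
  G ≅ C6 ⊎ G ≅ C6+1 ⊎ G ≅ C6+2 ⊎ G ≅ G4 ⊎
  (∃[ a ] ∃[ b ] ∃[ c ] G ≅ G5 a b c) ⊎
  (∃[ a ] ∃[ b ] ∃[ c ] ∃[ d ] G ≅ G6 a b c d)

-- Fix an induced 2K2 with edges rs and tu, the frame.  In a critical graph the other vertices
-- are independent (contracting an edge among them keeps the frame), so the graph is determined up
-- to isomorphism by how many outside vertices have each of the sixteen possible neighbourhoods in
-- {r, s, t, u}: it is a blow-up of a fixed graph on classes.  An outside vertex has a neighbour,
-- and if it saw only one frame edge, contracting that edge would leave a 2K2 with the other one;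
-- this leaves nine admissible types.  Criticality is inherited by induced subgraphs, so no critical
-- graph contains one of finitely many small obstructions (the frame with at most three outside
-- vertices).  A computation over all 3^9 multiplicity profiles capped at 2 shows that, up to the
-- eight symmetries of the frame, every profile avoiding them is one of the six listed families.
-- Conversely each listed graph is a blow-up in which a computation on classes finds no
-- contraction with an induced 2K2.
module Submission where

open import Defs hiding (sym; r; s; t; u; v; w; x; W; X; Y; Z)
open import Axiom.UniquenessOfIdentityProofs using (module Decidable⇒UIP)
open import Data.Bool using (Bool; true; false; _∨_; _∧_; not; T)
open import Data.Bool.ListAction using (all; any)
open import Data.Bool.Properties
  using (T-∧; T-≡; T-not-≡; ∨-comm; ¬-not; ∧-conicalˡ; ∧-conicalʳ) renaming (_≟_ to _≟ᵇ_)
open import Data.Empty using (⊥; ⊥-elim)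
open import Data.Fin using (Fin; zero; suc; toℕ; inject≤)
open import Data.Fin.Patterns using (0F; 1F; 2F; 3F; 4F; 5F; 6F; 7F; 8F)
open import Data.Fin.Properties using (inject≤-injective; +↔⊎; any?; all?) renaming (_≟_ to _≟ᶠ_)
open import Data.List as List using (List; []; _∷_; _++_; allFin; filter; cartesianProduct)
open import Data.List.Membership.Propositional using (_∈_)
open import Data.List.Membership.Propositional.Properties
  using (∈-map⁺; ∈-allFin; ∈-filter⁺; ∈-++⁺ˡ; ∈-++⁺ʳ)
import Data.List.Relation.Unary.All as All
open All using ([]; _∷_)
open import Data.List.Relation.Unary.All.Properties using (all⁺; all⁻)
import Data.List.Relation.Unary.Any as Any
open Any using (here; there; satisfied)
open import Data.List.Relation.Unary.Any.Properties using (any⁻)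
open import Data.Maybe using (Maybe; just; nothing)
open import Data.Nat using (ℕ; zero; suc; _+_; _≤_; _≤ᵇ_; z≤n; s≤s)
open import Data.Nat.Properties using (≤ᵇ⇒≤; ≤-trans; ≤-refl; n≤0⇒n≡0; ≮⇒≥)
open import Data.Product using (Σ; _×_; _,_; proj₁; proj₂)
open import Data.Product.Function.Dependent.Propositional using (Σ-↔)
open import Data.Product.Properties using (Σ-≡,≡→≡; Σ-≡,≡←≡; ≡-dec)
open import Data.Sum using (_⊎_; inj₁; inj₂)
open import Data.Sum.Function.Propositional using (_⊎-↔_)
open import Data.Vec using (Vec; []; _∷_; lookup; tabulate; replicate)
open import Data.Vec.Properties using (lookup∘tabulate; tabulate-cong; lookup-replicate)
  renaming (≡-dec to ≡-decᵛ)
open import Function using (_∘_; id; case_of_)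
open import Function.Bundles using (_⇔_; mk⇔; Equivalence; _↔_; Inverse; Injection; mk↔ₛ′)
open import Function.Properties.Inverse using (↔-sym; ↔-trans; ↔-refl; ↔⇒↣)
open import Level using (0ℓ)
open import Relation.Binary using (DecidableEquality)
open import Relation.Binary.PropositionalEquality
open import Relation.Nullary using (¬_; Dec; yes; no; Irrelevant)
open import Relation.Nullary.Decidable using (True; T?; map′; ⌊_⌋; toWitness; toWitnessFalse)
open import Relation.Unary using (Pred; Decidable)

private
  variable
    V U U′ : Set

-- Induced 2K2s, contractions and embeddings

Has2K2-adj : Graph V → Set
Has2K2-adj {V} G = Σ V λ a → Σ V λ b → Σ V λ c → Σ V λ d →
  Adj G a b × Adj G c d ×
  adj G a c ≡ false × adj G a d ≡ false × adj G b c ≡ false × adj G b d ≡ false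

NoContracted2K2 : Graph V → Set
NoContracted2K2 G = ∀ u v → Adj G u v → ¬ Has2K2-adj (contract G u v)

module _ (G : Graph V) where

  adjacent-≢-nonadjacent : ∀ {p p′ q} → Adj G p q → adj G p′ q ≡ false → p ≢ p′
  adjacent-≢-nonadjacent pq p′q refl = case trans (sym pq) p′q of λ ()

  has2K2-adj⇒has2K2 : Has2K2-adj G → Has2K2 G
  has2K2-adj⇒has2K2 (a , b , c , d , ab , cd , ac , ad , bc , bd) =
    a , b , c , d , ab , cd ,
    adjacent-≢-nonadjacent ab (flip bc) ,
    (λ a≡d → adjacent-≢-nonadjacent (flip cd) ac (sym a≡d)) ,
    adjacent-≢-nonadjacent (flip ab) (flip ac) ,
    adjacent-≢-nonadjacent (flip ab) (flip ad) ,
    ac , ad , bc , bd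
    where
    flip : ∀ {p q β} → adj G p q ≡ β → adj G q p ≡ β
    flip {p} {q} = trans (Graph.sym G q p)

  has2K2⇒has2K2-adj : Has2K2 G → Has2K2-adj G
  has2K2⇒has2K2-adj (a , b , c , d , ab , cd , _ , _ , _ , _ , ac , ad , bc , bd) =
    a , b , c , d , ab , cd , ac , ad , bc , bd

critically2K2Exist⇔ : (G : Graph V) → Critically2K2Exist G ⇔ (Has2K2-adj G × NoContracted2K2 G)
critically2K2Exist⇔ G = mk⇔
  (λ (h , none) → has2K2⇒has2K2-adj G h ,
                   λ u v uv h′ → none u v uv (has2K2-adj⇒has2K2 (contract G u v) h′))
  (λ (h , none) → has2K2-adj⇒has2K2 G h ,
                   λ u v uv h′ → none u v uv (has2K2⇒has2K2-adj (contract G u v) h′))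

AdjacencyPreserving : Graph U → Graph V → (U → V) → Set
AdjacencyPreserving H G f = ∀ x y → adj G (f x) (f y) ≡ adj H x y

record Embedding (H : Graph U) (G : Graph V) : Set where
  field
    map : U → V
    injective : ∀ {x y} → map x ≡ map y → x ≡ y
    adjacency : AdjacencyPreserving H G map

has2K2-adj-map : (H : Graph U) (G : Graph V) (f : U → V) →
  AdjacencyPreserving H G f → Has2K2-adj H → Has2K2-adj G
has2K2-adj-map H G f hom (a , b , c , d , ab , cd , ac , ad , bc , bd) =
  f a , f b , f c , f d , trans (hom a b) ab , trans (hom c d) cd ,
  trans (hom a c) ac , trans (hom a d) ad , trans (hom b c) bc , trans (hom b d) bd

module _ {H : Graph U} {G : Graph V} where

  module _ (e : Embedding H G) (u v : U) where
    open Embedding e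

    contractionMap : ContrV u v → ContrV (map u) (map v)
    contractionMap nothing = nothing
    contractionMap (just (x , x≢u , x≢v)) = just (map x , x≢u ∘ injective , x≢v ∘ injective)

    contractionMap-adjacency :
      AdjacencyPreserving (contract H u v) (contract G (map u) (map v)) contractionMap
    contractionMap-adjacency nothing nothing = refl
    contractionMap-adjacency nothing (just (y , _)) = cong₂ _∨_ (adjacency u y) (adjacency v y)
    contractionMap-adjacency (just (x , _)) nothing = cong₂ _∨_ (adjacency u x) (adjacency v x)
    contractionMap-adjacency (just (x , _)) (just (y , _)) = adjacency x y

  has2K2-adj-embedding : Embedding H G → Has2K2-adj H → Has2K2-adj G
  has2K2-adj-embedding e = has2K2-adj-map H G (Embedding.map e) (Embedding.adjacency e)

  noContracted2K2-hereditary : Embedding H G → NoContracted2K2 G → NoContracted2K2 H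
  noContracted2K2-hereditary e none u v uv h =
    none (map u) (map v) (trans (adjacency u v) uv)
      (has2K2-adj-map (contract H u v) (contract G (map u) (map v))
        (contractionMap e u v) (contractionMap-adjacency e u v) h)
    where open Embedding e

module _ {G : Graph V} {H : Graph U} where

  ≅⇒embedding : G ≅ H → Embedding G H
  ≅⇒embedding (f , hom) = record
    { map = Inverse.to f ; injective = Injection.injective (↔⇒↣ f) ; adjacency = hom }

  ≅-sym : G ≅ H → H ≅ G
  ≅-sym (f , hom) = ↔-sym f , λ x y →
    trans (sym (hom (Inverse.from f x) (Inverse.from f y)))
          (cong₂ (adj H) (Inverse.strictlyInverseˡ f x) (Inverse.strictlyInverseˡ f y))

  noIsolated-≅ : G ≅ H → NoIsolated G → NoIsolated H
  noIsolated-≅ (f , hom) noIsolated y with noIsolated (Inverse.from f y)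
  ... | z , adjacent = Inverse.to f z ,
    trans (cong (λ y′ → adj H y′ (Inverse.to f z)) (sym (Inverse.strictlyInverseˡ f y)))
          (trans (hom (Inverse.from f y) z) adjacent)

≅-trans : {G : Graph V} {H : Graph U} {K : Graph U′} → G ≅ H → H ≅ K → G ≅ K
≅-trans (f , homf) (g , homg) = ↔-trans f g , λ x y →
  trans (homg (Inverse.to f x) (Inverse.to f y)) (homf x y)

critical-≅ : {G : Graph V} {H : Graph U} → G ≅ H →
  Has2K2-adj H × NoContracted2K2 H → Has2K2-adj G × NoContracted2K2 G
critical-≅ {G = G} {H} iso (h , none) =
  has2K2-adj-embedding (≅⇒embedding {G = H} {H = G} (≅-sym {G = G} {H = H} iso)) h ,
  noContracted2K2-hereditary (≅⇒embedding iso) none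

-- Counting

indicator : {A : Set} → Dec A → ℕ
indicator (yes _) = 1
indicator (no _) = 0

dec↔Fin-indicator : {A : Set} → Irrelevant A → (a? : Dec A) → A ↔ Fin (indicator a?)
dec↔Fin-indicator irr (yes a) = mk↔ₛ′ (λ _ → zero) (λ _ → a) (λ { zero → refl }) (irr a)
dec↔Fin-indicator irr (no ¬a) = mk↔ₛ′ (⊥-elim ∘ ¬a) (λ ()) (λ ()) (⊥-elim ∘ ¬a)

count : ∀ {n} {P : Pred (Fin n) 0ℓ} → Decidable P → ℕ
count {zero} P? = 0
count {suc n} P? = indicator (P? zero) + count (P? ∘ suc)

Σ-Fin-suc↔ : ∀ {n} {P : Pred (Fin (suc n)) 0ℓ} → Σ (Fin (suc n)) P ↔ (P zero ⊎ Σ (Fin n) (P ∘ suc))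
Σ-Fin-suc↔ = mk↔ₛ′
  (λ { (zero , p) → inj₁ p ; (suc y , p) → inj₂ (y , p) })
  (λ { (inj₁ p) → zero , p ; (inj₂ (y , p)) → suc y , p })
  (λ { (inj₁ p) → refl ; (inj₂ (y , p)) → refl })
  (λ { (zero , p) → refl ; (suc y , p) → refl })

Σ↔Fin-count : ∀ {n} {P : Pred (Fin n) 0ℓ} → (∀ {y} → Irrelevant (P y)) →
  (P? : Decidable P) → Σ (Fin n) P ↔ Fin (count P?)
Σ↔Fin-count {zero} irr P? = mk↔ₛ′ (λ ()) (λ ()) (λ ()) (λ ())
Σ↔Fin-count {suc n} irr P? = ↔-trans Σ-Fin-suc↔
  (↔-trans (dec↔Fin-indicator irr (P? zero) ⊎-↔ Σ↔Fin-count irr (P? ∘ suc)) (↔-sym +↔⊎))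

count-unique : ∀ {n} {P : Pred (Fin n) 0ℓ} → (∀ {y} → Irrelevant (P y)) → (P? : Decidable P) →
  ∀ y₀ → P y₀ → (∀ y → P y → y ≡ y₀) → count P? ≡ 1
count-unique {P = P} irr P? y₀ Py₀ unique = size-one _ (Σ↔Fin-count irr P?)
  where
  size-one : ∀ m → Σ _ P ↔ Fin m → m ≡ 1
  size-one zero f = case Inverse.to f (y₀ , Py₀) of λ ()
  size-one (suc zero) _ = refl
  size-one (suc (suc _)) f = case Injection.injective (↔⇒↣ (↔-sym f)) same of λ ()
    where
    open Inverse f using (from)
    same : from zero ≡ from (suc zero)
    same = Σ-≡,≡→≡ (trans (unique _ (proj₂ (from zero))) (sym (unique _ (proj₂ (from (suc zero))))) ,
                    irr _ _)

count-cong : ∀ {n} {P Q : Pred (Fin n) 0ℓ} (P? : Decidable P) (Q? : Decidable Q) →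
  (∀ y → P y ⇔ Q y) → count P? ≡ count Q?
count-cong {zero} P? Q? P⇔Q = refl
count-cong {suc n} P? Q? P⇔Q =
  cong₂ _+_ (indicator-cong (P? zero) (Q? zero) (P⇔Q zero))
            (count-cong (P? ∘ suc) (Q? ∘ suc) (P⇔Q ∘ suc))
  where
  indicator-cong : {A B : Set} (a? : Dec A) (b? : Dec B) → A ⇔ B → indicator a? ≡ indicator b?
  indicator-cong (yes _) (yes _) _ = refl
  indicator-cong (no _) (no _) _ = refl
  indicator-cong (yes a) (no ¬b) a⇔b = ⊥-elim (¬b (Equivalence.to a⇔b a))
  indicator-cong (no ¬a) (yes b) a⇔b = ⊥-elim (¬a (Equivalence.from a⇔b b))

module _ {C : Set} (_≟_ : DecidableEquality C) where

  Fin↔Σ-fibres : ∀ {n} (κ : Fin n → C) → Fin n ↔ Σ C (λ k → Fin (count (λ y → κ y ≟ k)))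
  Fin↔Σ-fibres {n} κ =
    ↔-trans fibres (Σ-↔ ↔-refl (Σ↔Fin-count (Decidable⇒UIP.≡-irrelevant _≟_) _))
    where
    fibres : Fin n ↔ Σ C (λ k → Σ (Fin n) (λ y → κ y ≡ k))
    fibres = mk↔ₛ′ (λ y → κ y , y , refl) (proj₁ ∘ proj₂) (λ { (_ , _ , refl) → refl }) (λ _ → refl)

-- Vertex classes and blow-ups

-- Classes of vertices relative to a frame r, s, t, u (frame 0F … 3F, the edges being rs and tu).
-- A vertex outside the frame is classified by its neighbourhood in r, s, t, u: it is one of nine
-- types if it sees both frame edges, and otherwise one of seven excluded neighbourhoods.
data Class : Set where
  frame    : Fin 4 → Class
  type     : Fin 9 → Class
  excluded : Fin 7 → Class

neighbourhood : Class → Vec Bool 4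
neighbourhood (frame 0F)    = false ∷ true  ∷ false ∷ false ∷ []
neighbourhood (frame 1F)    = true  ∷ false ∷ false ∷ false ∷ []
neighbourhood (frame 2F)    = false ∷ false ∷ false ∷ true  ∷ []
neighbourhood (frame 3F)    = false ∷ false ∷ true  ∷ false ∷ []
neighbourhood (type 0F)     = true  ∷ false ∷ true  ∷ false ∷ []
neighbourhood (type 1F)     = true  ∷ false ∷ false ∷ true  ∷ []
neighbourhood (type 2F)     = true  ∷ false ∷ true  ∷ true  ∷ []
neighbourhood (type 3F)     = false ∷ true  ∷ true  ∷ false ∷ []
neighbourhood (type 4F)     = false ∷ true  ∷ false ∷ true  ∷ []
neighbourhood (type 5F)     = false ∷ true  ∷ true  ∷ true  ∷ []
neighbourhood (type 6F)     = true  ∷ true  ∷ true  ∷ false ∷ []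
neighbourhood (type 7F)     = true  ∷ true  ∷ false ∷ true  ∷ []
neighbourhood (type 8F)     = true  ∷ true  ∷ true  ∷ true  ∷ []
neighbourhood (excluded 0F) = false ∷ false ∷ false ∷ false ∷ []
neighbourhood (excluded 1F) = true  ∷ false ∷ false ∷ false ∷ []
neighbourhood (excluded 2F) = false ∷ true  ∷ false ∷ false ∷ []
neighbourhood (excluded 3F) = true  ∷ true  ∷ false ∷ false ∷ []
neighbourhood (excluded 4F) = false ∷ false ∷ true  ∷ false ∷ []
neighbourhood (excluded 5F) = false ∷ false ∷ false ∷ true  ∷ []
neighbourhood (excluded 6F) = false ∷ false ∷ true  ∷ true  ∷ []

classify : Vec Bool 4 → Class
classify (true  ∷ false ∷ true  ∷ false ∷ []) = type 0F
classify (true  ∷ false ∷ false ∷ true  ∷ []) = type 1F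
classify (true  ∷ false ∷ true  ∷ true  ∷ []) = type 2F
classify (false ∷ true  ∷ true  ∷ false ∷ []) = type 3F
classify (false ∷ true  ∷ false ∷ true  ∷ []) = type 4F
classify (false ∷ true  ∷ true  ∷ true  ∷ []) = type 5F
classify (true  ∷ true  ∷ true  ∷ false ∷ []) = type 6F
classify (true  ∷ true  ∷ false ∷ true  ∷ []) = type 7F
classify (true  ∷ true  ∷ true  ∷ true  ∷ []) = type 8F
classify (false ∷ false ∷ false ∷ false ∷ []) = excluded 0F
classify (true  ∷ false ∷ false ∷ false ∷ []) = excluded 1F
classify (false ∷ true  ∷ false ∷ false ∷ []) = excluded 2F
classify (true  ∷ true  ∷ false ∷ false ∷ []) = excluded 3F
classify (false ∷ false ∷ true  ∷ false ∷ []) = excluded 4F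
classify (false ∷ false ∷ false ∷ true  ∷ []) = excluded 5F
classify (false ∷ false ∷ true  ∷ true  ∷ []) = excluded 6F

neighbourhood-classify : ∀ bs → neighbourhood (classify bs) ≡ bs
neighbourhood-classify (true  ∷ false ∷ true  ∷ false ∷ []) = refl
neighbourhood-classify (true  ∷ false ∷ false ∷ true  ∷ []) = refl
neighbourhood-classify (true  ∷ false ∷ true  ∷ true  ∷ []) = refl
neighbourhood-classify (false ∷ true  ∷ true  ∷ false ∷ []) = refl
neighbourhood-classify (false ∷ true  ∷ false ∷ true  ∷ []) = refl
neighbourhood-classify (false ∷ true  ∷ true  ∷ true  ∷ []) = refl
neighbourhood-classify (true  ∷ true  ∷ true  ∷ false ∷ []) = refl
neighbourhood-classify (true  ∷ true  ∷ false ∷ true  ∷ []) = refl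
neighbourhood-classify (true  ∷ true  ∷ true  ∷ true  ∷ []) = refl
neighbourhood-classify (false ∷ false ∷ false ∷ false ∷ []) = refl
neighbourhood-classify (true  ∷ false ∷ false ∷ false ∷ []) = refl
neighbourhood-classify (false ∷ true  ∷ false ∷ false ∷ []) = refl
neighbourhood-classify (true  ∷ true  ∷ false ∷ false ∷ []) = refl
neighbourhood-classify (false ∷ false ∷ true  ∷ false ∷ []) = refl
neighbourhood-classify (false ∷ false ∷ false ∷ true  ∷ []) = refl
neighbourhood-classify (false ∷ false ∷ true  ∷ true  ∷ []) = refl

IsFrame : Class → Set
IsFrame k = Σ (Fin 4) λ j → k ≡ frame j

classify-nonframe : ∀ bs → ¬ IsFrame (classify bs)
classify-nonframe (true  ∷ false ∷ true  ∷ false ∷ []) (_ , ())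
classify-nonframe (true  ∷ false ∷ false ∷ true  ∷ []) (_ , ())
classify-nonframe (true  ∷ false ∷ true  ∷ true  ∷ []) (_ , ())
classify-nonframe (false ∷ true  ∷ true  ∷ false ∷ []) (_ , ())
classify-nonframe (false ∷ true  ∷ false ∷ true  ∷ []) (_ , ())
classify-nonframe (false ∷ true  ∷ true  ∷ true  ∷ []) (_ , ())
classify-nonframe (true  ∷ true  ∷ true  ∷ false ∷ []) (_ , ())
classify-nonframe (true  ∷ true  ∷ false ∷ true  ∷ []) (_ , ())
classify-nonframe (true  ∷ true  ∷ true  ∷ true  ∷ []) (_ , ())
classify-nonframe (false ∷ false ∷ false ∷ false ∷ []) (_ , ())
classify-nonframe (true  ∷ false ∷ false ∷ false ∷ []) (_ , ())
classify-nonframe (false ∷ true  ∷ false ∷ false ∷ []) (_ , ())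
classify-nonframe (true  ∷ true  ∷ false ∷ false ∷ []) (_ , ())
classify-nonframe (false ∷ false ∷ true  ∷ false ∷ []) (_ , ())
classify-nonframe (false ∷ false ∷ false ∷ true  ∷ []) (_ , ())
classify-nonframe (false ∷ false ∷ true  ∷ true  ∷ []) (_ , ())

classify-neighbourhood : ∀ k → ¬ IsFrame k → classify (neighbourhood k) ≡ k
classify-neighbourhood (frame j) k∉ = ⊥-elim (k∉ (j , refl))
classify-neighbourhood (type 0F) _ = refl
classify-neighbourhood (type 1F) _ = refl
classify-neighbourhood (type 2F) _ = refl
classify-neighbourhood (type 3F) _ = refl
classify-neighbourhood (type 4F) _ = refl
classify-neighbourhood (type 5F) _ = refl
classify-neighbourhood (type 6F) _ = refl
classify-neighbourhood (type 7F) _ = refl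
classify-neighbourhood (type 8F) _ = refl
classify-neighbourhood (excluded 0F) _ = refl
classify-neighbourhood (excluded 1F) _ = refl
classify-neighbourhood (excluded 2F) _ = refl
classify-neighbourhood (excluded 3F) _ = refl
classify-neighbourhood (excluded 4F) _ = refl
classify-neighbourhood (excluded 5F) _ = refl
classify-neighbourhood (excluded 6F) _ = refl

-- Classes outside the frame are pairwise non-adjacent, so every edge of the class graph
-- meets a frame class.
toFrame : Class → Class → Bool
toFrame k (frame j) = lookup (neighbourhood k) j
toFrame _ _ = false

toFrame-irreflexive : ∀ k → toFrame k k ≡ false
toFrame-irreflexive (frame 0F) = refl
toFrame-irreflexive (frame 1F) = refl
toFrame-irreflexive (frame 2F) = refl
toFrame-irreflexive (frame 3F) = refl
toFrame-irreflexive (type _) = refl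
toFrame-irreflexive (excluded _) = refl

infix 6 _~_
_~_ : Class → Class → Bool
k ~ l = toFrame k l ∨ toFrame l k

~-sym : ∀ k l → k ~ l ≡ l ~ k
~-sym k l = ∨-comm (toFrame k l) (toFrame l k)

nonframe-~ : ∀ k l → ¬ IsFrame k → ¬ IsFrame l → k ~ l ≡ false
nonframe-~ k (frame j) _ l∉ = ⊥-elim (l∉ (j , refl))
nonframe-~ (frame j) _ k∉ _ = ⊥-elim (k∉ (j , refl))
nonframe-~ (type _) (type _) _ _ = refl
nonframe-~ (type _) (excluded _) _ _ = refl
nonframe-~ (excluded _) (type _) _ _ = refl
nonframe-~ (excluded _) (excluded _) _ _ = refl

frame-~-nonframe : ∀ j k → ¬ IsFrame k → frame j ~ k ≡ lookup (neighbourhood k) j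
frame-~-nonframe j (frame i) k∉ = ⊥-elim (k∉ (i , refl))
frame-~-nonframe j (type _) _ = refl
frame-~-nonframe j (excluded _) _ = refl

isolated-~ : ∀ k → excluded 0F ~ k ≡ false
isolated-~ (frame 0F) = refl
isolated-~ (frame 1F) = refl
isolated-~ (frame 2F) = refl
isolated-~ (frame 3F) = refl
isolated-~ (type _) = refl
isolated-~ (excluded _) = refl

_≟ᶜ_ : DecidableEquality Class
frame i ≟ᶜ frame j = map′ (cong frame) (λ { refl → refl }) (i ≟ᶠ j)
type i ≟ᶜ type j = map′ (cong type) (λ { refl → refl }) (i ≟ᶠ j)
excluded i ≟ᶜ excluded j = map′ (cong excluded) (λ { refl → refl }) (i ≟ᶠ j)
frame _ ≟ᶜ type _ = no λ ()
frame _ ≟ᶜ excluded _ = no λ ()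
type _ ≟ᶜ frame _ = no λ ()
type _ ≟ᶜ excluded _ = no λ ()
excluded _ ≟ᶜ frame _ = no λ ()
excluded _ ≟ᶜ type _ = no λ ()

Vertex : (Class → ℕ) → Set
Vertex N = Σ Class (Fin ∘ N)

_≟ᵛ_ : ∀ {N} → DecidableEquality (Vertex N)
_≟ᵛ_ = ≡-dec _≟ᶜ_ _≟ᶠ_

BlowUp : (N : Class → ℕ) → Graph (Vertex N)
BlowUp N = fromEdges (λ a b → toFrame (proj₁ a) (proj₁ b)) (toFrame-irreflexive ∘ proj₁)

fibreSize : ∀ {n} → (Fin n → Class) → Class → ℕ
fibreSize κ k = count (λ y → κ y ≟ᶜ k)

fibreSize-unique : ∀ {n} (κ : Fin n → Class) {k} y₀ → κ y₀ ≡ k → (∀ y → κ y ≡ k → y ≡ y₀) →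
  fibreSize κ k ≡ 1
fibreSize-unique κ = count-unique (Decidable⇒UIP.≡-irrelevant _≟ᶜ_) _

≅-blowUp-fibreSize : ∀ {n} (G : FinGraph n) (κ : Fin n → Class) →
  (∀ p q → adj G p q ≡ κ p ~ κ q) → G ≅ BlowUp (fibreSize κ)
≅-blowUp-fibreSize G κ adj-κ = Fin↔Σ-fibres _≟ᶜ_ κ , λ p q → sym (adj-κ p q)

blowUp-cong : ∀ {N M} → (∀ k → N k ≡ M k) → BlowUp N ≅ BlowUp M
blowUp-cong N≗M = Σ-↔ ↔-refl (λ {k} → Fin-cast (N≗M k)) , λ _ _ → refl
  where
  Fin-cast : ∀ {m n} → m ≡ n → Fin m ↔ Fin n
  Fin-cast refl = ↔-refl

blowUp-mono : ∀ {N M} → (∀ k → N k ≤ M k) → Embedding (BlowUp N) (BlowUp M)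
blowUp-mono N≤M = record
  { map = λ (k , i) → k , inject≤ i (N≤M k)
  ; injective = injective
  ; adjacency = λ _ _ → refl }
  where
  injective : ∀ {a b} →
    (proj₁ a , inject≤ (proj₂ a) (N≤M _)) ≡ (proj₁ b , inject≤ (proj₂ b) (N≤M _)) → a ≡ b
  injective {k , i} {l , j} e with Σ-≡,≡←≡ e
  ... | refl , i≡j = cong (k ,_) (inject≤-injective _ _ i j i≡j)

isolatedClass-empty : ∀ {N} → NoIsolated (BlowUp N) → N (excluded 0F) ≡ 0
isolatedClass-empty {N} noIsolated with N (excluded 0F) in eq
... | zero = refl
... | suc _ with noIsolated (excluded 0F , subst Fin (sym eq) zero)
...   | y , adjacent = case trans (sym adjacent) (isolated-~ (proj₁ y)) of λ ()

profile : (Fin 9 → ℕ) → (Fin 7 → ℕ) → Class → ℕ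
profile c e (frame _) = 1
profile c e (type i) = c i
profile c e (excluded j) = e j

-- Deciding whether a contraction has an induced 2K2

-- Adjacency in the contraction of the edge uv, with nothing standing for the contracted vertex.
contractedAdj : {A : Set} → (A → A → Bool) → A → A → Maybe A → Maybe A → Bool
contractedAdj e u v nothing nothing = false
contractedAdj e u v nothing (just y) = e u y ∨ e v y
contractedAdj e u v (just y) nothing = e u y ∨ e v y
contractedAdj e u v (just y) (just y′) = e y y′

induced2K2Conditions : {M : Set} → (M → M → Bool) → (M → Bool) → (m₁ m₂ m₃ m₄ : M) → List Bool
induced2K2Conditions adj′ allowed m₁ m₂ m₃ m₄ =
  allowed m₁ ∷ allowed m₂ ∷ allowed m₃ ∷ allowed m₄ ∷ adj′ m₁ m₂ ∷ adj′ m₃ m₄ ∷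
  not (adj′ m₁ m₃) ∷ not (adj′ m₁ m₄) ∷ not (adj′ m₂ m₃) ∷ not (adj′ m₂ m₄) ∷ []

record Candidate (V : Set) : Set where
  constructor candidate
  field
    u v : V
    m₁ m₂ m₃ m₄ : Maybe V

module ContractionWitness {V : Set} (_≟_ : DecidableEquality V) (G : Graph V) (w : Candidate V) where
  open Candidate w

  avoidsEdge : Maybe V → Bool
  avoidsEdge nothing = true
  avoidsEdge (just y) = not ⌊ y ≟ u ⌋ ∧ not ⌊ y ≟ v ⌋

  conditions : List Bool
  conditions = adj G u v ∷ induced2K2Conditions (contractedAdj (adj G) u v) avoidsEdge m₁ m₂ m₃ m₄

  valid : Bool
  valid = all id conditions

  lift : (m : Maybe V) → T (avoidsEdge m) → ContrV u v
  lift nothing _ = nothing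
  lift (just y) avoids = just (y , toWitnessFalse {a? = y ≟ u} y≢u , toWitnessFalse {a? = y ≟ v} y≢v)
    where
    y≢u×y≢v = Equivalence.to (T-∧ {not ⌊ y ≟ u ⌋} {not ⌊ y ≟ v ⌋}) avoids
    y≢u = proj₁ y≢u×y≢v
    y≢v = proj₂ y≢u×y≢v

  lift-adj : ∀ m m′ a a′ →
    adj (contract G u v) (lift m a) (lift m′ a′) ≡ contractedAdj (adj G) u v m m′
  lift-adj nothing nothing _ _ = refl
  lift-adj nothing (just _) _ _ = refl
  lift-adj (just _) nothing _ _ = refl
  lift-adj (just _) (just _) _ _ = refl

  valid⇒¬noContracted2K2 : T valid → ¬ NoContracted2K2 G
  valid⇒¬noContracted2K2 w none with all⁺ id conditions w
  ... | uv ∷ a₁ ∷ a₂ ∷ a₃ ∷ a₄ ∷ e₁₂ ∷ e₃₄ ∷ n₁₃ ∷ n₁₄ ∷ n₂₃ ∷ n₂₄ ∷ [] =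
    none u v (true-≡ uv)
      (lift m₁ a₁ , lift m₂ a₂ , lift m₃ a₃ , lift m₄ a₄ ,
       trans (lift-adj m₁ m₂ a₁ a₂) (true-≡ e₁₂) , trans (lift-adj m₃ m₄ a₃ a₄) (true-≡ e₃₄) ,
       trans (lift-adj m₁ m₃ a₁ a₃) (false-≡ n₁₃) , trans (lift-adj m₁ m₄ a₁ a₄) (false-≡ n₁₄) ,
       trans (lift-adj m₂ m₃ a₂ a₃) (false-≡ n₂₃) , trans (lift-adj m₂ m₄ a₂ a₄) (false-≡ n₂₄))
    where
    true-≡ : ∀ {b} → T b → b ≡ true
    true-≡ = Equivalence.to T-≡
    false-≡ : ∀ {b} → T (not b) → b ≡ false
    false-≡ = Equivalence.to T-not-≡

allAt : {A : Set} {p : A → Bool} {xs : List A} {x : A} → T (all p xs) → x ∈ xs → T (p x)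
allAt {p = p} {xs} h = All.lookup (all⁺ p xs h)

-- In a blow-up, whether a contraction has an induced 2K2 depends only on the classes involved,
-- except that its vertices must differ from the ends of the contracted edge.  The check below
-- enforces this only for classes declared singleton; larger classes are treated as unlimited,
-- which can only make the check harder to pass.
module ClassCheck (singleton : Class → Bool) (classes : List Class) where

  options : List (Maybe Class)
  options = nothing ∷ List.map just classes

  module _ (ku kv : Class) where

    avoidsEdge : Maybe Class → Bool
    avoidsEdge nothing = true
    avoidsEdge (just k) = not (singleton k ∧ (⌊ k ≟ᶜ ku ⌋ ∨ ⌊ k ≟ᶜ kv ⌋))

    conditions : (m₁ m₂ m₃ m₄ : Maybe Class) → List Bool
    conditions = induced2K2Conditions (contractedAdj _~_ ku kv) avoidsEdge

    noWitnessFor : Bool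
    noWitnessFor = not (ku ~ kv) ∨
      all (λ m₁ → all (λ m₂ → all (λ m₃ → all (λ m₄ → not (all id (conditions m₁ m₂ m₃ m₄)))
        options) options) options) options

  noWitness : Bool
  noWitness = all (λ ku → all (noWitnessFor ku) classes) classes

  module Sound {N : Class → ℕ} (occurring : ∀ k → Fin (N k) → k ∈ classes)
    (unique : ∀ k → T (singleton k) → (i j : Fin (N k)) → i ≡ j) (check : T noWitness) where

    private
      G = BlowUp N

    module _ (a b : Vertex N) where

      classOf : ContrV a b → Maybe Class
      classOf nothing = nothing
      classOf (just (y , _)) = just (proj₁ y)

      classOf-∈ : ∀ m → classOf m ∈ options
      classOf-∈ nothing = here refl
      classOf-∈ (just ((k , i) , _)) = there (∈-map⁺ just (occurring k i))

      classOf-avoids : ∀ m → T (avoidsEdge (proj₁ a) (proj₁ b) (classOf m))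
      classOf-avoids nothing = _
      classOf-avoids (just ((k , i) , y≢a , y≢b))
        with singleton k in singleton-k | k ≟ᶜ proj₁ a | k ≟ᶜ proj₁ b
      ... | false | _ | _ = _
      ... | true | no _ | no _ = _
      ... | true | yes refl | _ =
        y≢a (cong (k ,_) (unique k (Equivalence.from T-≡ singleton-k) i (proj₂ a)))
      ... | true | no _ | yes refl =
        y≢b (cong (k ,_) (unique k (Equivalence.from T-≡ singleton-k) i (proj₂ b)))

      classOf-adj : ∀ m m′ →
        adj (contract G a b) m m′ ≡ contractedAdj _~_ (proj₁ a) (proj₁ b) (classOf m) (classOf m′)
      classOf-adj nothing nothing = refl
      classOf-adj nothing (just _) = refl
      classOf-adj (just _) nothing = refl
      classOf-adj (just _) (just _) = refl

    noContracted2K2 : NoContracted2K2 G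
    noContracted2K2 a b ab (m₁ , m₂ , m₃ , m₄ , e₁₂ , e₃₄ , n₁₃ , n₁₄ , n₂₃ , n₂₄) =
      case trans (sym classWitness) (Equivalence.to T-not-≡ noClassWitness) of λ ()
      where
      resolve : ∀ {x y} → T (not x ∨ y) → x ≡ true → T y
      resolve {true} h refl = h
      resolve {false} _ ()
      noClassWitness = allAt (allAt (allAt (allAt
        (resolve (allAt (allAt check (occurring _ (proj₂ a))) (occurring _ (proj₂ b))) ab)
        (classOf-∈ a b m₁)) (classOf-∈ a b m₂)) (classOf-∈ a b m₃)) (classOf-∈ a b m₄)
      adjacent : ∀ m m′ → adj (contract G a b) m m′ ≡ true →
        T (contractedAdj _~_ (proj₁ a) (proj₁ b) (classOf a b m) (classOf a b m′))
      adjacent m m′ e = Equivalence.from T-≡ (trans (sym (classOf-adj a b m m′)) e)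
      nonadjacent : ∀ m m′ → adj (contract G a b) m m′ ≡ false →
        T (not (contractedAdj _~_ (proj₁ a) (proj₁ b) (classOf a b m) (classOf a b m′)))
      nonadjacent m m′ e = Equivalence.from T-not-≡ (trans (sym (classOf-adj a b m m′)) e)
      classWitness :
        all id (conditions _ _ (classOf a b m₁) (classOf a b m₂) (classOf a b m₃) (classOf a b m₄))
          ≡ true
      classWitness = Equivalence.to T-≡ (all⁻ id
        (classOf-avoids a b m₁ ∷ classOf-avoids a b m₂ ∷ classOf-avoids a b m₃ ∷ classOf-avoids a b m₄ ∷
         adjacent m₁ m₂ e₁₂ ∷ adjacent m₃ m₄ e₃₄ ∷
         nonadjacent m₁ m₃ n₁₃ ∷ nonadjacent m₁ m₄ n₁₄ ∷
         nonadjacent m₂ m₃ n₂₃ ∷ nonadjacent m₂ m₄ n₂₄ ∷ []))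

-- Frames

record Frame {n : ℕ} (G : FinGraph n) : Set where
  field
    corner : Fin 4 → Fin n
    corner-adj : ∀ i j → adj G (corner i) (corner j) ≡ frame i ~ frame j
    outside-independent : ∀ p q → (∀ i → p ≢ corner i) → (∀ i → q ≢ corner i) → adj G p q ≡ false

frame-rows-injective : ∀ i j → (∀ k → frame i ~ frame k ≡ frame j ~ frame k) → i ≡ j
frame-rows-injective 0F 0F _ = refl
frame-rows-injective 1F 1F _ = refl
frame-rows-injective 2F 2F _ = refl
frame-rows-injective 3F 3F _ = refl
frame-rows-injective 0F 1F rows = case rows 1F of λ ()
frame-rows-injective 0F 2F rows = case rows 1F of λ ()
frame-rows-injective 0F 3F rows = case rows 1F of λ ()
frame-rows-injective 1F 0F rows = case rows 0F of λ ()
frame-rows-injective 1F 2F rows = case rows 0F of λ ()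
frame-rows-injective 1F 3F rows = case rows 0F of λ ()
frame-rows-injective 2F 0F rows = case rows 3F of λ ()
frame-rows-injective 2F 1F rows = case rows 3F of λ ()
frame-rows-injective 2F 3F rows = case rows 3F of λ ()
frame-rows-injective 3F 0F rows = case rows 2F of λ ()
frame-rows-injective 3F 1F rows = case rows 2F of λ ()
frame-rows-injective 3F 2F rows = case rows 2F of λ ()

module FrameClasses {n : ℕ} {G : FinGraph n} (F : Frame G) where
  open Frame F

  corner-injective : ∀ {i j} → corner i ≡ corner j → i ≡ j
  corner-injective {i} {j} e = frame-rows-injective i j λ k →
    trans (sym (corner-adj i k)) (trans (cong (λ p → adj G p (corner k)) e) (corner-adj j k))

  data Position (p : Fin n) : Set where
    at-corner : ∀ i → p ≡ corner i → Position p
    outside : (∀ i → p ≢ corner i) → Position p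

  position : ∀ p → Position p
  position p with any? (λ i → p ≟ᶠ corner i)
  ... | yes (i , p≡cᵢ) = at-corner i p≡cᵢ
  ... | no ¬corner = outside λ i p≡cᵢ → ¬corner (i , p≡cᵢ)

  neighbourhoodOf : Fin n → Vec Bool 4
  neighbourhoodOf p = tabulate (λ i → adj G p (corner i))

  classAt : ∀ {p} → Position p → Class
  classAt (at-corner i _) = frame i
  classAt {p} (outside _) = classify (neighbourhoodOf p)

  classOf : Fin n → Class
  classOf p = classAt (position p)

  classOf-corner : ∀ i → classOf (corner i) ≡ frame i
  classOf-corner i with position (corner i)
  ... | at-corner j cᵢ≡cⱼ = cong frame (sym (corner-injective cᵢ≡cⱼ))
  ... | outside out = ⊥-elim (out i refl)

  classOf-outside : ∀ {p} → (∀ i → p ≢ corner i) → classOf p ≡ classify (neighbourhoodOf p)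
  classOf-outside {p} out with position p
  ... | at-corner i p≡cᵢ = ⊥-elim (out i p≡cᵢ)
  ... | outside _ = refl

  classOf-frame : ∀ {p i} → classOf p ≡ frame i → p ≡ corner i
  classOf-frame {p} e with position p
  ... | at-corner j refl = cong corner (frame-injective e)
    where frame-injective : ∀ {i j} → frame i ≡ frame j → i ≡ j
          frame-injective refl = refl
  ... | outside _ = ⊥-elim (classify-nonframe (neighbourhoodOf p) (_ , e))

  corner-~-outside : ∀ i q → adj G (corner i) q ≡ frame i ~ classify (neighbourhoodOf q)
  corner-~-outside i q = begin
    adj G (corner i) q
      ≡⟨ Graph.sym G (corner i) q ⟩
    adj G q (corner i)
      ≡⟨ sym (lookup∘tabulate (λ j → adj G q (corner j)) i) ⟩
    lookup (neighbourhoodOf q) i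
      ≡⟨ cong (λ bs → lookup bs i) (sym (neighbourhood-classify (neighbourhoodOf q))) ⟩
    lookup (neighbourhood (classify (neighbourhoodOf q))) i
      ≡⟨ sym (frame-~-nonframe i _ (classify-nonframe (neighbourhoodOf q))) ⟩
    frame i ~ classify (neighbourhoodOf q) ∎
    where open ≡-Reasoning

  adj-classOf : ∀ p q → adj G p q ≡ classOf p ~ classOf q
  adj-classOf p q with position p | position q
  ... | at-corner i refl | at-corner j refl = corner-adj i j
  ... | at-corner i refl | outside _ = corner-~-outside i q
  ... | outside _ | at-corner j refl = trans (Graph.sym G p (corner j))
    (trans (corner-~-outside j p) (~-sym (frame j) (classify (neighbourhoodOf p))))
  ... | outside p-out | outside q-out = trans (outside-independent p q p-out q-out)
    (sym (nonframe-~ _ _ (classify-nonframe (neighbourhoodOf p))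
                         (classify-nonframe (neighbourhoodOf q))))

  frameCount : ∀ i → fibreSize classOf (frame i) ≡ 1
  frameCount i = fibreSize-unique classOf (corner i) (classOf-corner i) (λ _ → classOf-frame)

  typeCount : Fin 9 → ℕ
  typeCount i = fibreSize classOf (type i)

  excludedCount : Fin 7 → ℕ
  excludedCount j = fibreSize classOf (excluded j)

  ≅-blowUp-profile : G ≅ BlowUp (profile typeCount excludedCount)
  ≅-blowUp-profile =
    ≅-trans {G = G} {H = BlowUp (fibreSize classOf)} {K = BlowUp (profile typeCount excludedCount)}
      (≅-blowUp-fibreSize G classOf adj-classOf) (blowUp-cong counts)
    where
    counts : ∀ k → fibreSize classOf k ≡ profile typeCount excludedCount k
    counts (frame i) = frameCount i
    counts (type _) = refl
    counts (excluded _) = refl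

module _ {n : ℕ} {G : FinGraph n} (none : NoContracted2K2 G) where

  frameOf2K2 : Has2K2-adj G → Frame G
  frameOf2K2 (a , b , c , d , ab , cd , ac , ad , bc , bd) = record
    { corner = corner ; corner-adj = corner-adj ; outside-independent = outside-independent }
    where
    corner : Fin 4 → Fin n
    corner i = lookup (a ∷ b ∷ c ∷ d ∷ []) i
    flip : ∀ {p q β} → adj G p q ≡ β → adj G q p ≡ β
    flip {p} {q} = trans (Graph.sym G q p)
    corner-adj : ∀ i j → adj G (corner i) (corner j) ≡ frame i ~ frame j
    corner-adj 0F 0F = irref G a
    corner-adj 0F 1F = ab
    corner-adj 0F 2F = ac
    corner-adj 0F 3F = ad
    corner-adj 1F 0F = flip ab
    corner-adj 1F 1F = irref G b
    corner-adj 1F 2F = bc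
    corner-adj 1F 3F = bd
    corner-adj 2F 0F = flip ac
    corner-adj 2F 1F = flip bc
    corner-adj 2F 2F = irref G c
    corner-adj 2F 3F = cd
    corner-adj 3F 0F = flip ad
    corner-adj 3F 1F = flip bd
    corner-adj 3F 2F = flip cd
    corner-adj 3F 3F = irref G d
    -- Contracting an edge between two outside vertices would keep abcd as an induced 2K2.
    outside-independent : ∀ p q → (∀ i → p ≢ corner i) → (∀ i → q ≢ corner i) → adj G p q ≡ false
    outside-independent p q p-out q-out = ¬-not λ pq → none p q pq
      (keep 0F , keep 1F , keep 2F , keep 3F , ab , cd , ac , ad , bc , bd)
      where
      keep : ∀ i → ContrV p q
      keep i = just (corner i , (λ e → p-out i (sym e)) , (λ e → q-out i (sym e)))

-- Symmetries of the frame

permute : (Fin 4 → Fin 4) → Vec Bool 4 → Vec Bool 4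
permute π bs = tabulate (λ j → lookup bs (π j))

record FrameSymmetry : Set where
  field
    onFrame : Fin 4 → Fin 4
    onTypes : Fin 9 → Fin 9
    onExcluded : Fin 7 → Fin 7
    onFrame-involutive : ∀ i → onFrame (onFrame i) ≡ i
    onTypes-involutive : ∀ i → onTypes (onTypes i) ≡ i
    onExcluded-involutive : ∀ j → onExcluded (onExcluded j) ≡ j
    onFrame-~ : ∀ i j → frame (onFrame i) ~ frame (onFrame j) ≡ frame i ~ frame j
    onTypes-neighbourhood : ∀ i →
      neighbourhood (type (onTypes i)) ≡ permute onFrame (neighbourhood (type i))
    onExcluded-neighbourhood : ∀ j →
      neighbourhood (excluded (onExcluded j)) ≡ permute onFrame (neighbourhood (excluded j))

  act : Class → Class
  act (frame i) = frame (onFrame i)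
  act (type i) = type (onTypes i)
  act (excluded j) = excluded (onExcluded j)

  act-involutive : ∀ k → act (act k) ≡ k
  act-involutive (frame i) = cong frame (onFrame-involutive i)
  act-involutive (type i) = cong type (onTypes-involutive i)
  act-involutive (excluded j) = cong excluded (onExcluded-involutive j)

  act-nonframe : ∀ k → ¬ IsFrame k → act k ≡ classify (permute onFrame (neighbourhood k))
  act-nonframe (frame j) k∉ = ⊥-elim (k∉ (j , refl))
  act-nonframe (type i) _ = trans (sym (classify-neighbourhood (type (onTypes i)) λ ()))
    (cong classify (onTypes-neighbourhood i))
  act-nonframe (excluded j) _ = trans (sym (classify-neighbourhood (excluded (onExcluded j)) λ ()))
    (cong classify (onExcluded-neighbourhood j))

module Reframe {n : ℕ} {G : FinGraph n} (F : Frame G) (σ : FrameSymmetry) where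
  open FrameSymmetry σ
  open Frame F

  reframed : Frame G
  reframed = record
    { corner = corner ∘ onFrame
    ; corner-adj = λ i j → trans (corner-adj (onFrame i) (onFrame j)) (onFrame-~ i j)
    ; outside-independent = λ p q p-out q-out →
        outside-independent p q (unframe p-out) (unframe q-out) }
    where
    unframe : ∀ {p} → (∀ i → p ≢ corner (onFrame i)) → ∀ i → p ≢ corner i
    unframe out i p≡cᵢ = out (onFrame i) (trans p≡cᵢ (cong corner (sym (onFrame-involutive i))))

  private
    module Old = FrameClasses F
    module New = FrameClasses reframed

  classOf-reframed : ∀ p → New.classOf p ≡ act (Old.classOf p)
  classOf-reframed p with Old.position p
  ... | Old.at-corner i refl = begin
    New.classOf (corner i)
      ≡⟨ cong (New.classOf ∘ corner) (sym (onFrame-involutive i)) ⟩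
    New.classOf (corner (onFrame (onFrame i)))
      ≡⟨ New.classOf-corner (onFrame i) ⟩
    frame (onFrame i) ∎
    where open ≡-Reasoning
  ... | Old.outside out = begin
    New.classOf p
      ≡⟨ New.classOf-outside (λ i → out (onFrame i)) ⟩
    classify (New.neighbourhoodOf p)
      ≡⟨ cong classify (tabulate-cong λ j →
           sym (lookup∘tabulate (λ i → adj G p (corner i)) (onFrame j))) ⟩
    classify (permute onFrame (Old.neighbourhoodOf p))
      ≡⟨ cong (classify ∘ permute onFrame) (sym (neighbourhood-classify (Old.neighbourhoodOf p))) ⟩
    classify (permute onFrame (neighbourhood (classify (Old.neighbourhoodOf p))))
      ≡⟨ sym (act-nonframe _ (classify-nonframe (Old.neighbourhoodOf p))) ⟩
    act (classify (Old.neighbourhoodOf p)) ∎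
    where open ≡-Reasoning

  typeCount-reframed : ∀ i → New.typeCount i ≡ Old.typeCount (onTypes i)
  typeCount-reframed i = count-cong _ _ λ y → mk⇔
    (λ e → trans (sym (act-involutive _)) (cong act (trans (sym (classOf-reframed y)) e)))
    (λ e → trans (classOf-reframed y) (trans (cong act e) (cong type (onTypes-involutive i))))

frameSymmetry : (onFrame : Vec (Fin 4) 4) (onTypes : Vec (Fin 9) 9) (onExcluded : Vec (Fin 7) 7) →
  {True (all? λ i → lookup onFrame (lookup onFrame i) ≟ᶠ i)} →
  {True (all? λ i → lookup onTypes (lookup onTypes i) ≟ᶠ i)} →
  {True (all? λ j → lookup onExcluded (lookup onExcluded j) ≟ᶠ j)} →
  {True (all? λ i → all? λ j →
     frame (lookup onFrame i) ~ frame (lookup onFrame j) ≟ᵇ frame i ~ frame j)} →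
  {True (all? λ i → ≡-decᵛ _≟ᵇ_ (neighbourhood (type (lookup onTypes i)))
                                (permute (lookup onFrame) (neighbourhood (type i))))} →
  {True (all? λ j → ≡-decᵛ _≟ᵇ_ (neighbourhood (excluded (lookup onExcluded j)))
                                (permute (lookup onFrame) (neighbourhood (excluded j))))} →
  FrameSymmetry
frameSymmetry π τ ε {p₁} {p₂} {p₃} {p₄} {p₅} {p₆} = record
  { onFrame = lookup π ; onTypes = lookup τ ; onExcluded = lookup ε
  ; onFrame-involutive = toWitness p₁
  ; onTypes-involutive = toWitness p₂
  ; onExcluded-involutive = toWitness p₃
  ; onFrame-~ = toWitness p₄
  ; onTypes-neighbourhood = toWitness p₅
  ; onExcluded-neighbourhood = toWitness p₆ }

swapRS swapTU swapEdges : FrameSymmetry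
swapRS = frameSymmetry (1F ∷ 0F ∷ 2F ∷ 3F ∷ [])
  (3F ∷ 4F ∷ 5F ∷ 0F ∷ 1F ∷ 2F ∷ 6F ∷ 7F ∷ 8F ∷ []) (0F ∷ 2F ∷ 1F ∷ 3F ∷ 4F ∷ 5F ∷ 6F ∷ [])
swapTU = frameSymmetry (0F ∷ 1F ∷ 3F ∷ 2F ∷ [])
  (1F ∷ 0F ∷ 2F ∷ 4F ∷ 3F ∷ 5F ∷ 7F ∷ 6F ∷ 8F ∷ []) (0F ∷ 1F ∷ 2F ∷ 3F ∷ 5F ∷ 4F ∷ 6F ∷ [])
swapEdges = frameSymmetry (2F ∷ 3F ∷ 0F ∷ 1F ∷ [])
  (0F ∷ 3F ∷ 6F ∷ 1F ∷ 4F ∷ 7F ∷ 2F ∷ 5F ∷ 8F ∷ []) (0F ∷ 4F ∷ 5F ∷ 6F ∷ 1F ∷ 2F ∷ 3F ∷ [])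

-- Obstructions

-- A blow-up with a contraction that has an induced 2K2, recorded with its witness.  The frame
-- classes are present once, types and excluded classes with the given numbers of copies.
record Obstruction : Set where
  constructor obstruction
  field
    typeCopies : Vec ℕ 9
    excludedCopies : Vec ℕ 7
  shape : Class → ℕ
  shape = profile (lookup typeCopies) (lookup excludedCopies)
  field
    witness : Candidate (Vertex shape)

  valid : Bool
  valid = ContractionWitness.valid _≟ᵛ_ (BlowUp shape) witness

fr : ∀ {c e} → Fin 4 → Vertex (profile c e)
fr i = frame i , 0F

ty : ∀ {c e} (i : Fin 9) → Fin (c i) → Vertex (profile c e)
ty i x = type i , x

ex : ∀ {c e} (j : Fin 7) → Fin (e j) → Vertex (profile c e)
ex j x = excluded j , x

obstruction-absent : ∀ {c e} → NoContracted2K2 (BlowUp (profile c e)) →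
  (O : Obstruction) → T (Obstruction.valid O) →
  (∀ i → lookup (Obstruction.typeCopies O) i ≤ c i) →
  ¬ (∀ j → lookup (Obstruction.excludedCopies O) j ≤ e j)
obstruction-absent none O isValid types≤ excluded≤ =
  ContractionWitness.valid⇒¬noContracted2K2 _≟ᵛ_ (BlowUp shape) witness isValid
    (noContracted2K2-hereditary (blowUp-mono shape≤) none)
  where
  open Obstruction O
  shape≤ : ∀ k → shape k ≤ _
  shape≤ (frame _) = ≤-refl
  shape≤ (type i) = types≤ i
  shape≤ (excluded j) = excluded≤ j

record TypeObstruction : Set where
  constructor typeObstruction
  field
    copies : Vec ℕ 9
    witness : Candidate (Vertex (profile (lookup copies) (lookup (replicate 7 0))))

  asObstruction : Obstruction
  asObstruction = obstruction copies (replicate 7 0) witness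

typeObstructions : List TypeObstruction
typeObstructions =
  typeObstruction (0 ∷ 0 ∷ 0 ∷ 0 ∷ 0 ∷ 1 ∷ 0 ∷ 1 ∷ 1 ∷ [])
    (candidate (fr 1F) (ty 8F 0F) (just (fr 0F)) (just (ty 7F 0F)) (just (fr 2F)) (just (ty 5F 0F))) ∷
  typeObstruction (0 ∷ 0 ∷ 0 ∷ 0 ∷ 0 ∷ 1 ∷ 0 ∷ 2 ∷ 0 ∷ [])
    (candidate (fr 0F) (ty 7F 0F) nothing (just (ty 7F 1F)) (just (fr 2F)) (just (ty 5F 0F))) ∷
  typeObstruction (0 ∷ 0 ∷ 0 ∷ 0 ∷ 0 ∷ 1 ∷ 1 ∷ 0 ∷ 1 ∷ [])
    (candidate (fr 1F) (ty 8F 0F) (just (fr 0F)) (just (ty 6F 0F)) (just (fr 3F)) (just (ty 5F 0F))) ∷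
  typeObstruction (0 ∷ 0 ∷ 0 ∷ 0 ∷ 0 ∷ 1 ∷ 1 ∷ 1 ∷ 0 ∷ [])
    (candidate (fr 1F) (ty 6F 0F) (just (fr 0F)) (just (ty 7F 0F)) (just (fr 2F)) (just (ty 5F 0F))) ∷
  typeObstruction (0 ∷ 0 ∷ 0 ∷ 0 ∷ 0 ∷ 1 ∷ 2 ∷ 0 ∷ 0 ∷ [])
    (candidate (fr 0F) (ty 6F 0F) nothing (just (ty 6F 1F)) (just (fr 3F)) (just (ty 5F 0F))) ∷
  typeObstruction (0 ∷ 0 ∷ 0 ∷ 0 ∷ 0 ∷ 2 ∷ 0 ∷ 1 ∷ 0 ∷ [])
    (candidate (fr 1F) (ty 5F 0F) (just (fr 0F)) (just (ty 7F 0F)) (just (fr 2F)) (just (ty 5F 1F))) ∷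
  typeObstruction (0 ∷ 0 ∷ 0 ∷ 0 ∷ 0 ∷ 2 ∷ 1 ∷ 0 ∷ 0 ∷ [])
    (candidate (fr 1F) (ty 5F 0F) (just (fr 0F)) (just (ty 6F 0F)) (just (fr 3F)) (just (ty 5F 1F))) ∷
  typeObstruction (0 ∷ 0 ∷ 0 ∷ 0 ∷ 1 ∷ 0 ∷ 1 ∷ 0 ∷ 1 ∷ [])
    (candidate (fr 1F) (ty 8F 0F) (just (fr 0F)) (just (ty 6F 0F)) (just (fr 3F)) (just (ty 4F 0F))) ∷
  typeObstruction (0 ∷ 0 ∷ 0 ∷ 0 ∷ 1 ∷ 0 ∷ 1 ∷ 1 ∷ 0 ∷ [])
    (candidate (fr 1F) (ty 7F 0F) (just (fr 0F)) (just (ty 6F 0F)) (just (fr 3F)) (just (ty 4F 0F))) ∷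
  typeObstruction (0 ∷ 0 ∷ 0 ∷ 0 ∷ 1 ∷ 0 ∷ 2 ∷ 0 ∷ 0 ∷ [])
    (candidate (fr 0F) (ty 6F 0F) nothing (just (ty 6F 1F)) (just (fr 3F)) (just (ty 4F 0F))) ∷
  typeObstruction (0 ∷ 0 ∷ 0 ∷ 0 ∷ 1 ∷ 1 ∷ 0 ∷ 1 ∷ 0 ∷ [])
    (candidate (fr 1F) (ty 4F 0F) (just (fr 0F)) (just (ty 7F 0F)) (just (fr 2F)) (just (ty 5F 0F))) ∷
  typeObstruction (0 ∷ 0 ∷ 0 ∷ 0 ∷ 1 ∷ 1 ∷ 1 ∷ 0 ∷ 0 ∷ [])
    (candidate (fr 1F) (ty 4F 0F) (just (fr 0F)) (just (ty 6F 0F)) (just (fr 3F)) (just (ty 5F 0F))) ∷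
  typeObstruction (0 ∷ 0 ∷ 0 ∷ 0 ∷ 2 ∷ 0 ∷ 1 ∷ 0 ∷ 0 ∷ [])
    (candidate (fr 1F) (ty 4F 0F) (just (fr 0F)) (just (ty 6F 0F)) (just (fr 3F)) (just (ty 4F 1F))) ∷
  typeObstruction (0 ∷ 0 ∷ 0 ∷ 1 ∷ 0 ∷ 0 ∷ 0 ∷ 1 ∷ 1 ∷ [])
    (candidate (fr 1F) (ty 8F 0F) (just (fr 0F)) (just (ty 7F 0F)) (just (fr 2F)) (just (ty 3F 0F))) ∷
  typeObstruction (0 ∷ 0 ∷ 0 ∷ 1 ∷ 0 ∷ 0 ∷ 0 ∷ 2 ∷ 0 ∷ [])
    (candidate (fr 0F) (ty 7F 0F) nothing (just (ty 7F 1F)) (just (fr 2F)) (just (ty 3F 0F))) ∷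
  typeObstruction (0 ∷ 0 ∷ 0 ∷ 1 ∷ 0 ∷ 0 ∷ 1 ∷ 1 ∷ 0 ∷ [])
    (candidate (fr 1F) (ty 6F 0F) (just (fr 0F)) (just (ty 7F 0F)) (just (fr 2F)) (just (ty 3F 0F))) ∷
  typeObstruction (0 ∷ 0 ∷ 0 ∷ 1 ∷ 0 ∷ 1 ∷ 0 ∷ 1 ∷ 0 ∷ [])
    (candidate (fr 1F) (ty 3F 0F) (just (fr 0F)) (just (ty 7F 0F)) (just (fr 2F)) (just (ty 5F 0F))) ∷
  typeObstruction (0 ∷ 0 ∷ 0 ∷ 1 ∷ 0 ∷ 1 ∷ 1 ∷ 0 ∷ 0 ∷ [])
    (candidate (fr 1F) (ty 3F 0F) (just (fr 0F)) (just (ty 6F 0F)) (just (fr 3F)) (just (ty 5F 0F))) ∷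
  typeObstruction (0 ∷ 0 ∷ 0 ∷ 1 ∷ 1 ∷ 0 ∷ 0 ∷ 1 ∷ 0 ∷ [])
    (candidate (fr 1F) (ty 4F 0F) (just (fr 0F)) (just (ty 7F 0F)) (just (fr 2F)) (just (ty 3F 0F))) ∷
  typeObstruction (0 ∷ 0 ∷ 0 ∷ 1 ∷ 1 ∷ 0 ∷ 1 ∷ 0 ∷ 0 ∷ [])
    (candidate (fr 1F) (ty 3F 0F) (just (fr 0F)) (just (ty 6F 0F)) (just (fr 3F)) (just (ty 4F 0F))) ∷
  typeObstruction (0 ∷ 0 ∷ 0 ∷ 2 ∷ 0 ∷ 0 ∷ 0 ∷ 1 ∷ 0 ∷ [])
    (candidate (fr 1F) (ty 3F 0F) (just (fr 0F)) (just (ty 7F 0F)) (just (fr 2F)) (just (ty 3F 1F))) ∷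
  typeObstruction (0 ∷ 0 ∷ 1 ∷ 0 ∷ 0 ∷ 0 ∷ 0 ∷ 1 ∷ 1 ∷ [])
    (candidate (fr 0F) (ty 8F 0F) (just (fr 1F)) (just (ty 7F 0F)) (just (fr 2F)) (just (ty 2F 0F))) ∷
  typeObstruction (0 ∷ 0 ∷ 1 ∷ 0 ∷ 0 ∷ 0 ∷ 0 ∷ 2 ∷ 0 ∷ [])
    (candidate (fr 0F) (ty 7F 0F) (just (fr 1F)) (just (ty 7F 1F)) (just (fr 2F)) (just (ty 2F 0F))) ∷
  typeObstruction (0 ∷ 0 ∷ 1 ∷ 0 ∷ 0 ∷ 0 ∷ 1 ∷ 0 ∷ 1 ∷ [])
    (candidate (fr 0F) (ty 8F 0F) (just (fr 1F)) (just (ty 6F 0F)) (just (fr 3F)) (just (ty 2F 0F))) ∷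
  typeObstruction (0 ∷ 0 ∷ 1 ∷ 0 ∷ 0 ∷ 0 ∷ 1 ∷ 1 ∷ 0 ∷ [])
    (candidate (fr 0F) (ty 6F 0F) (just (fr 1F)) (just (ty 7F 0F)) (just (fr 2F)) (just (ty 2F 0F))) ∷
  typeObstruction (0 ∷ 0 ∷ 1 ∷ 0 ∷ 0 ∷ 0 ∷ 2 ∷ 0 ∷ 0 ∷ [])
    (candidate (fr 0F) (ty 6F 0F) (just (fr 1F)) (just (ty 6F 1F)) (just (fr 3F)) (just (ty 2F 0F))) ∷
  typeObstruction (0 ∷ 0 ∷ 1 ∷ 0 ∷ 0 ∷ 1 ∷ 0 ∷ 1 ∷ 0 ∷ [])
    (candidate (fr 3F) (ty 2F 0F) (just (fr 0F)) (just (ty 7F 0F)) (just (fr 2F)) (just (ty 5F 0F))) ∷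
  typeObstruction (0 ∷ 0 ∷ 1 ∷ 0 ∷ 0 ∷ 1 ∷ 1 ∷ 0 ∷ 0 ∷ [])
    (candidate (fr 2F) (ty 2F 0F) (just (fr 0F)) (just (ty 6F 0F)) (just (fr 3F)) (just (ty 5F 0F))) ∷
  typeObstruction (0 ∷ 0 ∷ 1 ∷ 0 ∷ 1 ∷ 0 ∷ 0 ∷ 0 ∷ 1 ∷ [])
    (candidate (fr 0F) (ty 8F 0F) (just (fr 1F)) (just (ty 4F 0F)) (just (fr 2F)) (just (ty 2F 0F))) ∷
  typeObstruction (0 ∷ 0 ∷ 1 ∷ 0 ∷ 1 ∷ 0 ∷ 0 ∷ 1 ∷ 0 ∷ [])
    (candidate (fr 0F) (ty 7F 0F) (just (fr 1F)) (just (ty 4F 0F)) (just (fr 2F)) (just (ty 2F 0F))) ∷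
  typeObstruction (0 ∷ 0 ∷ 1 ∷ 0 ∷ 1 ∷ 0 ∷ 1 ∷ 0 ∷ 0 ∷ [])
    (candidate (fr 0F) (ty 6F 0F) (just (fr 1F)) (just (ty 4F 0F)) (just (fr 2F)) (just (ty 2F 0F))) ∷
  typeObstruction (0 ∷ 0 ∷ 1 ∷ 0 ∷ 1 ∷ 1 ∷ 0 ∷ 0 ∷ 0 ∷ [])
    (candidate (fr 3F) (ty 5F 0F) (just (fr 1F)) (just (ty 4F 0F)) (just (fr 2F)) (just (ty 2F 0F))) ∷
  typeObstruction (0 ∷ 0 ∷ 1 ∷ 0 ∷ 2 ∷ 0 ∷ 0 ∷ 0 ∷ 0 ∷ [])
    (candidate (fr 1F) (ty 4F 0F) nothing (just (ty 4F 1F)) (just (fr 2F)) (just (ty 2F 0F))) ∷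
  typeObstruction (0 ∷ 0 ∷ 1 ∷ 1 ∷ 0 ∷ 0 ∷ 0 ∷ 0 ∷ 1 ∷ [])
    (candidate (fr 0F) (ty 8F 0F) (just (fr 1F)) (just (ty 3F 0F)) (just (fr 3F)) (just (ty 2F 0F))) ∷
  typeObstruction (0 ∷ 0 ∷ 1 ∷ 1 ∷ 0 ∷ 0 ∷ 0 ∷ 1 ∷ 0 ∷ [])
    (candidate (fr 0F) (ty 7F 0F) (just (fr 1F)) (just (ty 3F 0F)) (just (fr 3F)) (just (ty 2F 0F))) ∷
  typeObstruction (0 ∷ 0 ∷ 1 ∷ 1 ∷ 0 ∷ 0 ∷ 1 ∷ 0 ∷ 0 ∷ [])
    (candidate (fr 0F) (ty 6F 0F) (just (fr 1F)) (just (ty 3F 0F)) (just (fr 3F)) (just (ty 2F 0F))) ∷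
  typeObstruction (0 ∷ 0 ∷ 1 ∷ 1 ∷ 0 ∷ 1 ∷ 0 ∷ 0 ∷ 0 ∷ [])
    (candidate (fr 2F) (ty 5F 0F) (just (fr 1F)) (just (ty 3F 0F)) (just (fr 3F)) (just (ty 2F 0F))) ∷
  typeObstruction (0 ∷ 0 ∷ 1 ∷ 2 ∷ 0 ∷ 0 ∷ 0 ∷ 0 ∷ 0 ∷ [])
    (candidate (fr 1F) (ty 3F 0F) nothing (just (ty 3F 1F)) (just (fr 3F)) (just (ty 2F 0F))) ∷
  typeObstruction (0 ∷ 0 ∷ 2 ∷ 0 ∷ 0 ∷ 0 ∷ 0 ∷ 1 ∷ 0 ∷ [])
    (candidate (fr 0F) (ty 2F 0F) (just (fr 1F)) (just (ty 7F 0F)) (just (fr 2F)) (just (ty 2F 1F))) ∷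
  typeObstruction (0 ∷ 0 ∷ 2 ∷ 0 ∷ 0 ∷ 0 ∷ 1 ∷ 0 ∷ 0 ∷ [])
    (candidate (fr 0F) (ty 2F 0F) (just (fr 1F)) (just (ty 6F 0F)) (just (fr 3F)) (just (ty 2F 1F))) ∷
  typeObstruction (0 ∷ 0 ∷ 2 ∷ 0 ∷ 1 ∷ 0 ∷ 0 ∷ 0 ∷ 0 ∷ [])
    (candidate (fr 0F) (ty 2F 0F) (just (fr 1F)) (just (ty 4F 0F)) (just (fr 2F)) (just (ty 2F 1F))) ∷
  typeObstruction (0 ∷ 0 ∷ 2 ∷ 1 ∷ 0 ∷ 0 ∷ 0 ∷ 0 ∷ 0 ∷ [])
    (candidate (fr 0F) (ty 2F 0F) (just (fr 1F)) (just (ty 3F 0F)) (just (fr 3F)) (just (ty 2F 1F))) ∷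
  typeObstruction (0 ∷ 1 ∷ 0 ∷ 0 ∷ 0 ∷ 0 ∷ 1 ∷ 0 ∷ 1 ∷ [])
    (candidate (fr 0F) (ty 8F 0F) (just (fr 1F)) (just (ty 6F 0F)) (just (fr 3F)) (just (ty 1F 0F))) ∷
  typeObstruction (0 ∷ 1 ∷ 0 ∷ 0 ∷ 0 ∷ 0 ∷ 1 ∷ 1 ∷ 0 ∷ [])
    (candidate (fr 0F) (ty 7F 0F) (just (fr 1F)) (just (ty 6F 0F)) (just (fr 3F)) (just (ty 1F 0F))) ∷
  typeObstruction (0 ∷ 1 ∷ 0 ∷ 0 ∷ 0 ∷ 0 ∷ 2 ∷ 0 ∷ 0 ∷ [])
    (candidate (fr 0F) (ty 6F 0F) (just (fr 1F)) (just (ty 6F 1F)) (just (fr 3F)) (just (ty 1F 0F))) ∷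
  typeObstruction (0 ∷ 1 ∷ 0 ∷ 0 ∷ 0 ∷ 1 ∷ 0 ∷ 0 ∷ 1 ∷ [])
    (candidate (fr 1F) (ty 8F 0F) (just (fr 0F)) (just (ty 1F 0F)) (just (fr 2F)) (just (ty 5F 0F))) ∷
  typeObstruction (0 ∷ 1 ∷ 0 ∷ 0 ∷ 0 ∷ 1 ∷ 0 ∷ 1 ∷ 0 ∷ [])
    (candidate (fr 0F) (ty 1F 0F) nothing (just (ty 7F 0F)) (just (fr 2F)) (just (ty 5F 0F))) ∷
  typeObstruction (0 ∷ 1 ∷ 0 ∷ 0 ∷ 0 ∷ 1 ∷ 1 ∷ 0 ∷ 0 ∷ [])
    (candidate (fr 1F) (ty 6F 0F) (just (fr 0F)) (just (ty 1F 0F)) (just (fr 2F)) (just (ty 5F 0F))) ∷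
  typeObstruction (0 ∷ 1 ∷ 0 ∷ 0 ∷ 0 ∷ 2 ∷ 0 ∷ 0 ∷ 0 ∷ [])
    (candidate (fr 1F) (ty 5F 0F) (just (fr 0F)) (just (ty 1F 0F)) (just (fr 2F)) (just (ty 5F 1F))) ∷
  typeObstruction (0 ∷ 1 ∷ 0 ∷ 0 ∷ 1 ∷ 1 ∷ 0 ∷ 0 ∷ 0 ∷ [])
    (candidate (fr 1F) (ty 4F 0F) (just (fr 0F)) (just (ty 1F 0F)) (just (fr 2F)) (just (ty 5F 0F))) ∷
  typeObstruction (0 ∷ 1 ∷ 0 ∷ 1 ∷ 0 ∷ 0 ∷ 0 ∷ 0 ∷ 1 ∷ [])
    (candidate (fr 0F) (ty 8F 0F) (just (fr 1F)) (just (ty 3F 0F)) (just (fr 3F)) (just (ty 1F 0F))) ∷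
  typeObstruction (0 ∷ 1 ∷ 0 ∷ 1 ∷ 0 ∷ 0 ∷ 0 ∷ 1 ∷ 0 ∷ [])
    (candidate (fr 0F) (ty 1F 0F) nothing (just (ty 7F 0F)) (just (fr 2F)) (just (ty 3F 0F))) ∷
  typeObstruction (0 ∷ 1 ∷ 0 ∷ 1 ∷ 0 ∷ 0 ∷ 1 ∷ 0 ∷ 0 ∷ [])
    (candidate (fr 0F) (ty 6F 0F) (just (fr 1F)) (just (ty 3F 0F)) (just (fr 3F)) (just (ty 1F 0F))) ∷
  typeObstruction (0 ∷ 1 ∷ 0 ∷ 1 ∷ 0 ∷ 1 ∷ 0 ∷ 0 ∷ 0 ∷ [])
    (candidate (fr 1F) (ty 3F 0F) (just (fr 0F)) (just (ty 1F 0F)) (just (fr 2F)) (just (ty 5F 0F))) ∷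
  typeObstruction (0 ∷ 1 ∷ 0 ∷ 1 ∷ 1 ∷ 0 ∷ 0 ∷ 0 ∷ 0 ∷ [])
    (candidate (fr 1F) (ty 4F 0F) (just (fr 0F)) (just (ty 1F 0F)) (just (fr 2F)) (just (ty 3F 0F))) ∷
  typeObstruction (0 ∷ 1 ∷ 0 ∷ 2 ∷ 0 ∷ 0 ∷ 0 ∷ 0 ∷ 0 ∷ [])
    (candidate (fr 1F) (ty 3F 0F) nothing (just (ty 3F 1F)) (just (fr 3F)) (just (ty 1F 0F))) ∷
  typeObstruction (0 ∷ 1 ∷ 1 ∷ 0 ∷ 0 ∷ 0 ∷ 0 ∷ 1 ∷ 0 ∷ [])
    (candidate (fr 0F) (ty 1F 0F) (just (fr 1F)) (just (ty 7F 0F)) (just (fr 2F)) (just (ty 2F 0F))) ∷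
  typeObstruction (0 ∷ 1 ∷ 1 ∷ 0 ∷ 0 ∷ 0 ∷ 1 ∷ 0 ∷ 0 ∷ [])
    (candidate (fr 0F) (ty 1F 0F) (just (fr 1F)) (just (ty 6F 0F)) (just (fr 3F)) (just (ty 2F 0F))) ∷
  typeObstruction (0 ∷ 1 ∷ 1 ∷ 0 ∷ 0 ∷ 1 ∷ 0 ∷ 0 ∷ 0 ∷ [])
    (candidate (fr 3F) (ty 2F 0F) (just (fr 0F)) (just (ty 1F 0F)) (just (fr 2F)) (just (ty 5F 0F))) ∷
  typeObstruction (0 ∷ 1 ∷ 1 ∷ 0 ∷ 1 ∷ 0 ∷ 0 ∷ 0 ∷ 0 ∷ [])
    (candidate (fr 0F) (ty 1F 0F) (just (fr 1F)) (just (ty 4F 0F)) (just (fr 2F)) (just (ty 2F 0F))) ∷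
  typeObstruction (0 ∷ 1 ∷ 1 ∷ 1 ∷ 0 ∷ 0 ∷ 0 ∷ 0 ∷ 0 ∷ [])
    (candidate (fr 0F) (ty 1F 0F) (just (fr 1F)) (just (ty 3F 0F)) (just (fr 3F)) (just (ty 2F 0F))) ∷
  typeObstruction (0 ∷ 2 ∷ 0 ∷ 0 ∷ 0 ∷ 0 ∷ 1 ∷ 0 ∷ 0 ∷ [])
    (candidate (fr 0F) (ty 1F 0F) (just (fr 1F)) (just (ty 6F 0F)) (just (fr 3F)) (just (ty 1F 1F))) ∷
  typeObstruction (0 ∷ 2 ∷ 0 ∷ 0 ∷ 0 ∷ 1 ∷ 0 ∷ 0 ∷ 0 ∷ [])
    (candidate (fr 0F) (ty 1F 0F) nothing (just (ty 1F 1F)) (just (fr 2F)) (just (ty 5F 0F))) ∷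
  typeObstruction (0 ∷ 2 ∷ 0 ∷ 1 ∷ 0 ∷ 0 ∷ 0 ∷ 0 ∷ 0 ∷ [])
    (candidate (fr 0F) (ty 1F 0F) nothing (just (ty 1F 1F)) (just (fr 2F)) (just (ty 3F 0F))) ∷
  typeObstruction (1 ∷ 0 ∷ 0 ∷ 0 ∷ 0 ∷ 0 ∷ 0 ∷ 1 ∷ 1 ∷ [])
    (candidate (fr 0F) (ty 8F 0F) (just (fr 1F)) (just (ty 7F 0F)) (just (fr 2F)) (just (ty 0F 0F))) ∷
  typeObstruction (1 ∷ 0 ∷ 0 ∷ 0 ∷ 0 ∷ 0 ∷ 0 ∷ 2 ∷ 0 ∷ [])
    (candidate (fr 0F) (ty 7F 0F) (just (fr 1F)) (just (ty 7F 1F)) (just (fr 2F)) (just (ty 0F 0F))) ∷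
  typeObstruction (1 ∷ 0 ∷ 0 ∷ 0 ∷ 0 ∷ 0 ∷ 1 ∷ 1 ∷ 0 ∷ [])
    (candidate (fr 0F) (ty 6F 0F) (just (fr 1F)) (just (ty 7F 0F)) (just (fr 2F)) (just (ty 0F 0F))) ∷
  typeObstruction (1 ∷ 0 ∷ 0 ∷ 0 ∷ 0 ∷ 1 ∷ 0 ∷ 0 ∷ 1 ∷ [])
    (candidate (fr 1F) (ty 8F 0F) (just (fr 0F)) (just (ty 0F 0F)) (just (fr 3F)) (just (ty 5F 0F))) ∷
  typeObstruction (1 ∷ 0 ∷ 0 ∷ 0 ∷ 0 ∷ 1 ∷ 0 ∷ 1 ∷ 0 ∷ [])
    (candidate (fr 1F) (ty 7F 0F) (just (fr 0F)) (just (ty 0F 0F)) (just (fr 3F)) (just (ty 5F 0F))) ∷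
  typeObstruction (1 ∷ 0 ∷ 0 ∷ 0 ∷ 0 ∷ 1 ∷ 1 ∷ 0 ∷ 0 ∷ [])
    (candidate (fr 0F) (ty 0F 0F) nothing (just (ty 6F 0F)) (just (fr 3F)) (just (ty 5F 0F))) ∷
  typeObstruction (1 ∷ 0 ∷ 0 ∷ 0 ∷ 0 ∷ 2 ∷ 0 ∷ 0 ∷ 0 ∷ [])
    (candidate (fr 1F) (ty 5F 0F) (just (fr 0F)) (just (ty 0F 0F)) (just (fr 3F)) (just (ty 5F 1F))) ∷
  typeObstruction (1 ∷ 0 ∷ 0 ∷ 0 ∷ 1 ∷ 0 ∷ 0 ∷ 0 ∷ 1 ∷ [])
    (candidate (fr 0F) (ty 8F 0F) (just (fr 1F)) (just (ty 4F 0F)) (just (fr 2F)) (just (ty 0F 0F))) ∷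
  typeObstruction (1 ∷ 0 ∷ 0 ∷ 0 ∷ 1 ∷ 0 ∷ 0 ∷ 1 ∷ 0 ∷ [])
    (candidate (fr 0F) (ty 7F 0F) (just (fr 1F)) (just (ty 4F 0F)) (just (fr 2F)) (just (ty 0F 0F))) ∷
  typeObstruction (1 ∷ 0 ∷ 0 ∷ 0 ∷ 1 ∷ 0 ∷ 1 ∷ 0 ∷ 0 ∷ [])
    (candidate (fr 0F) (ty 0F 0F) nothing (just (ty 6F 0F)) (just (fr 3F)) (just (ty 4F 0F))) ∷
  typeObstruction (1 ∷ 0 ∷ 0 ∷ 0 ∷ 1 ∷ 1 ∷ 0 ∷ 0 ∷ 0 ∷ [])
    (candidate (fr 1F) (ty 4F 0F) (just (fr 0F)) (just (ty 0F 0F)) (just (fr 3F)) (just (ty 5F 0F))) ∷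
  typeObstruction (1 ∷ 0 ∷ 0 ∷ 0 ∷ 2 ∷ 0 ∷ 0 ∷ 0 ∷ 0 ∷ [])
    (candidate (fr 1F) (ty 4F 0F) nothing (just (ty 4F 1F)) (just (fr 2F)) (just (ty 0F 0F))) ∷
  typeObstruction (1 ∷ 0 ∷ 0 ∷ 1 ∷ 0 ∷ 1 ∷ 0 ∷ 0 ∷ 0 ∷ [])
    (candidate (fr 1F) (ty 3F 0F) (just (fr 0F)) (just (ty 0F 0F)) (just (fr 3F)) (just (ty 5F 0F))) ∷
  typeObstruction (1 ∷ 0 ∷ 0 ∷ 1 ∷ 1 ∷ 0 ∷ 0 ∷ 0 ∷ 0 ∷ [])
    (candidate (fr 1F) (ty 3F 0F) (just (fr 0F)) (just (ty 0F 0F)) (just (fr 3F)) (just (ty 4F 0F))) ∷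
  typeObstruction (1 ∷ 0 ∷ 1 ∷ 0 ∷ 0 ∷ 0 ∷ 0 ∷ 1 ∷ 0 ∷ [])
    (candidate (fr 0F) (ty 0F 0F) (just (fr 1F)) (just (ty 7F 0F)) (just (fr 2F)) (just (ty 2F 0F))) ∷
  typeObstruction (1 ∷ 0 ∷ 1 ∷ 0 ∷ 0 ∷ 0 ∷ 1 ∷ 0 ∷ 0 ∷ [])
    (candidate (fr 0F) (ty 0F 0F) (just (fr 1F)) (just (ty 6F 0F)) (just (fr 3F)) (just (ty 2F 0F))) ∷
  typeObstruction (1 ∷ 0 ∷ 1 ∷ 0 ∷ 0 ∷ 1 ∷ 0 ∷ 0 ∷ 0 ∷ [])
    (candidate (fr 2F) (ty 2F 0F) (just (fr 0F)) (just (ty 0F 0F)) (just (fr 3F)) (just (ty 5F 0F))) ∷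
  typeObstruction (1 ∷ 0 ∷ 1 ∷ 0 ∷ 1 ∷ 0 ∷ 0 ∷ 0 ∷ 0 ∷ [])
    (candidate (fr 0F) (ty 0F 0F) (just (fr 1F)) (just (ty 4F 0F)) (just (fr 2F)) (just (ty 2F 0F))) ∷
  typeObstruction (1 ∷ 0 ∷ 1 ∷ 1 ∷ 0 ∷ 0 ∷ 0 ∷ 0 ∷ 0 ∷ [])
    (candidate (fr 0F) (ty 0F 0F) (just (fr 1F)) (just (ty 3F 0F)) (just (fr 3F)) (just (ty 2F 0F))) ∷
  typeObstruction (1 ∷ 1 ∷ 0 ∷ 0 ∷ 0 ∷ 0 ∷ 0 ∷ 1 ∷ 0 ∷ [])
    (candidate (fr 0F) (ty 1F 0F) (just (fr 1F)) (just (ty 7F 0F)) (just (fr 2F)) (just (ty 0F 0F))) ∷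
  typeObstruction (1 ∷ 1 ∷ 0 ∷ 0 ∷ 0 ∷ 0 ∷ 1 ∷ 0 ∷ 0 ∷ [])
    (candidate (fr 0F) (ty 0F 0F) (just (fr 1F)) (just (ty 6F 0F)) (just (fr 3F)) (just (ty 1F 0F))) ∷
  typeObstruction (1 ∷ 1 ∷ 0 ∷ 0 ∷ 1 ∷ 0 ∷ 0 ∷ 0 ∷ 0 ∷ [])
    (candidate (fr 0F) (ty 1F 0F) (just (fr 1F)) (just (ty 4F 0F)) (just (fr 2F)) (just (ty 0F 0F))) ∷
  typeObstruction (1 ∷ 1 ∷ 0 ∷ 1 ∷ 0 ∷ 0 ∷ 0 ∷ 0 ∷ 0 ∷ [])
    (candidate (fr 0F) (ty 0F 0F) (just (fr 1F)) (just (ty 3F 0F)) (just (fr 3F)) (just (ty 1F 0F))) ∷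
  typeObstruction (2 ∷ 0 ∷ 0 ∷ 0 ∷ 0 ∷ 0 ∷ 0 ∷ 1 ∷ 0 ∷ [])
    (candidate (fr 0F) (ty 0F 0F) (just (fr 1F)) (just (ty 7F 0F)) (just (fr 2F)) (just (ty 0F 1F))) ∷
  typeObstruction (2 ∷ 0 ∷ 0 ∷ 0 ∷ 0 ∷ 1 ∷ 0 ∷ 0 ∷ 0 ∷ [])
    (candidate (fr 0F) (ty 0F 0F) nothing (just (ty 0F 1F)) (just (fr 3F)) (just (ty 5F 0F))) ∷
  typeObstruction (2 ∷ 0 ∷ 0 ∷ 0 ∷ 1 ∷ 0 ∷ 0 ∷ 0 ∷ 0 ∷ [])
    (candidate (fr 0F) (ty 0F 0F) nothing (just (ty 0F 1F)) (just (fr 3F)) (just (ty 4F 0F))) ∷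
  []

typeObstructions-valid : T (all (Obstruction.valid ∘ TypeObstruction.asObstruction) typeObstructions)
typeObstructions-valid = _

oneAt : Fin 7 → Vec ℕ 7
oneAt j = tabulate λ k → indicator (k ≟ᶠ j)

-- A vertex seeing only the edge rs (only tu) forms, together with the vertex obtained by
-- contracting rs (tu), a 2K2 with the other frame edge.
sideCandidate : (j : Fin 6) →
  Candidate (Vertex (profile (lookup (replicate 9 0)) (lookup (oneAt (suc j)))))
sideCandidate 0F = candidate (fr 0F) (fr 1F) nothing (just (ex 1F 0F)) (just (fr 2F)) (just (fr 3F))
sideCandidate 1F = candidate (fr 0F) (fr 1F) nothing (just (ex 2F 0F)) (just (fr 2F)) (just (fr 3F))
sideCandidate 2F = candidate (fr 0F) (fr 1F) nothing (just (ex 3F 0F)) (just (fr 2F)) (just (fr 3F))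
sideCandidate 3F = candidate (fr 2F) (fr 3F) nothing (just (ex 4F 0F)) (just (fr 0F)) (just (fr 1F))
sideCandidate 4F = candidate (fr 2F) (fr 3F) nothing (just (ex 5F 0F)) (just (fr 0F)) (just (fr 1F))
sideCandidate 5F = candidate (fr 2F) (fr 3F) nothing (just (ex 6F 0F)) (just (fr 0F)) (just (fr 1F))

sideObstruction : Fin 6 → Obstruction
sideObstruction j = obstruction (replicate 9 0) (oneAt (suc j)) (sideCandidate j)

sideObstruction-valid : ∀ j → T (Obstruction.valid (sideObstruction j))
sideObstruction-valid 0F = _
sideObstruction-valid 1F = _
sideObstruction-valid 2F = _
sideObstruction-valid 3F = _
sideObstruction-valid 4F = _
sideObstruction-valid 5F = _

oneAt-≤ : ∀ {e : Fin 7 → ℕ} j → 1 ≤ e j → ∀ k → lookup (oneAt j) k ≤ e k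
oneAt-≤ j 1≤eⱼ k rewrite lookup∘tabulate (λ k → indicator (k ≟ᶠ j)) k with k ≟ᶠ j
... | yes refl = 1≤eⱼ
... | no _ = z≤n

sideCopies-absent : ∀ {c e} → NoContracted2K2 (BlowUp (profile c e)) → ∀ j → e (suc j) ≡ 0
sideCopies-absent {c} none j = n≤0⇒n≡0 (≮⇒≥ λ 1≤eⱼ →
  obstruction-absent none (sideObstruction j) (sideObstruction-valid j)
    (λ i → subst (λ m → m ≤ c i) (sym (lookup-replicate i 0)) z≤n) (oneAt-≤ (suc j) 1≤eⱼ))

-- The exhaustive check

-- Multiplicities are only ever compared with 0, 1 and 2: an obstruction uses at most two copies
-- of a type, and a family either prescribes 0 or 1 copies of a type or leaves the number free.
level : ℕ → Fin 3
level zero = 0F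
level (suc zero) = 1F
level (suc (suc _)) = 2F

level-≤ : ∀ m → toℕ (level m) ≤ m
level-≤ zero = z≤n
level-≤ (suc zero) = s≤s z≤n
level-≤ (suc (suc _)) = s≤s (s≤s z≤n)

Configuration : Set
Configuration = Vec (Fin 3) 9

allZip : ∀ {A B : Set} {k} → (A → B → Bool) → Vec A k → Vec B k → Bool
allZip R [] [] = true
allZip R (a ∷ as) (b ∷ bs) = R a b ∧ allZip R as bs

allZip-sound : ∀ {A B : Set} {k} (R : A → B → Bool) (as : Vec A k) (bs : Vec B k) →
  T (allZip R as bs) → ∀ i → T (R (lookup as i) (lookup bs i))
allZip-sound R (a ∷ as) (b ∷ bs) ok zero = proj₁ (Equivalence.to (T-∧ {R a b}) ok)
allZip-sound R (a ∷ as) (b ∷ bs) ok (suc i) =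
  allZip-sound R as bs (proj₂ (Equivalence.to (T-∧ {R a b}) ok)) i

contains : Configuration → TypeObstruction → Bool
contains cv O = allZip (λ m l → m ≤ᵇ toℕ l) (TypeObstruction.copies O) cv

data Multiplicity : Set where
  absent single several : Multiplicity

copies : Multiplicity → ℕ → ℕ
copies absent _ = 0
copies single _ = 1
copies several m = m

fits : Multiplicity → Fin 3 → Bool
fits absent 0F = true
fits single 1F = true
fits several _ = true
fits _ _ = false

fits-level : ∀ μ m → T (fits μ (level m)) → m ≡ copies μ m
fits-level absent zero _ = refl
fits-level single (suc zero) _ = refl
fits-level several _ _ = refl
fits-level absent (suc zero) ()
fits-level absent (suc (suc _)) ()
fits-level single zero ()
fits-level single (suc (suc _)) ()

data Family : Set where
  c₆ c₆+chord c₆+chords g₄ g₅ g₆ : Family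

families : List Family
families = c₆ ∷ c₆+chord ∷ c₆+chords ∷ g₄ ∷ g₅ ∷ g₆ ∷ []

familyShape : Family → Vec Multiplicity 9
familyShape c₆        = absent  ∷ single  ∷ absent  ∷ single  ∷ absent  ∷ absent  ∷ absent  ∷ absent  ∷ absent  ∷ []
familyShape c₆+chord  = absent  ∷ single  ∷ absent  ∷ absent  ∷ absent  ∷ absent  ∷ single  ∷ absent  ∷ absent  ∷ []
familyShape c₆+chords = absent  ∷ absent  ∷ single  ∷ absent  ∷ absent  ∷ absent  ∷ single  ∷ absent  ∷ absent  ∷ []
familyShape g₄        = single  ∷ single  ∷ absent  ∷ absent  ∷ absent  ∷ single  ∷ absent  ∷ absent  ∷ absent  ∷ []
familyShape g₅        = absent  ∷ absent  ∷ several ∷ absent  ∷ absent  ∷ several ∷ absent  ∷ absent  ∷ several ∷ []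
familyShape g₆        = absent  ∷ absent  ∷ absent  ∷ several ∷ several ∷ several ∷ absent  ∷ absent  ∷ several ∷ []

familyProfile : Family → (Fin 9 → ℕ) → Fin 9 → ℕ
familyProfile f c i = copies (lookup (familyShape f) i) (c i)

matches : Family → Configuration → Bool
matches f cv = allZip fits (familyShape f) cv

applyIf : Bool → FrameSymmetry → Configuration → Configuration
applyIf false σ cv = cv
applyIf true σ cv = tabulate (λ i → lookup cv (FrameSymmetry.onTypes σ i))

orient : Bool → Bool → Bool → Configuration → Configuration
orient b₁ b₂ b₃ = applyIf b₃ swapEdges ∘ applyIf b₂ swapTU ∘ applyIf b₁ swapRS

Orientation : Set
Orientation = Bool × Bool × Bool

orientations : List Orientation
orientations = cartesianProduct bools (cartesianProduct bools bools)
  where bools = true ∷ false ∷ []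

matchesSomeFamily : Configuration → Bool
matchesSomeFamily cv = any (λ f → matches f cv) families

identified : Configuration → Bool
identified cv = any (λ (b₁ , b₂ , b₃) → matchesSomeFamily (orient b₁ b₂ b₃ cv)) orientations

classified : Configuration → Bool
classified cv = any (contains cv) typeObstructions ∨ identified cv

checkAll : ∀ k → (Vec (Fin 3) k → Bool) → Bool
checkAll zero P = P []
checkAll (suc k) P = checkAll k (P ∘ (0F ∷_)) ∧ checkAll k (P ∘ (1F ∷_)) ∧ checkAll k (P ∘ (2F ∷_))

checkAll-sound : ∀ k (P : Vec (Fin 3) k → Bool) → checkAll k P ≡ true → ∀ cv → P cv ≡ true
checkAll-sound zero P ok [] = ok
checkAll-sound (suc k) P ok (c ∷ cv) = checkAll-sound k (P ∘ (c ∷_)) (branch c) cv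
  where
  sub : Fin 3 → Bool
  sub c = checkAll k (P ∘ (c ∷_))
  branch : ∀ c → sub c ≡ true
  branch 0F = ∧-conicalˡ (sub 0F) _ ok
  branch 1F = ∧-conicalˡ (sub 1F) _ (∧-conicalʳ (sub 0F) _ ok)
  branch 2F = ∧-conicalʳ (sub 1F) _ (∧-conicalʳ (sub 0F) _ ok)

-- Stated with _≡_ and refl: checking T (checkAll 9 classified) instead, or reducing that type
-- anywhere, is several times slower.
all-classified : checkAll 9 classified ≡ true
all-classified = refl

identified-witness : ∀ {cv} → identified cv ≡ true →
  Σ Orientation λ (b₁ , b₂ , b₃) → Σ Family λ f → matches f (orient b₁ b₂ b₃ cv) ≡ true
identified-witness {cv} ok =
  let (b₁ , b₂ , b₃) , some =
        satisfied (any⁻ (λ (b₁ , b₂ , b₃) → matchesSomeFamily (orient b₁ b₂ b₃ cv))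
                        orientations (Equivalence.from T-≡ ok))
      f , matching = satisfied (any⁻ (λ f → matches f (orient b₁ b₂ b₃ cv)) families some)
  in (b₁ , b₂ , b₃) , f , Equivalence.to T-≡ matching

-- The six families

≅-blowUp-by-classes : (L : Graph V) {N : Class → ℕ} (κ : V → Class)
  (index : ∀ p → Fin (N (κ p))) (vertexAt : ∀ k → Fin (N k) → V) →
  (∀ p → vertexAt (κ p) (index p) ≡ p) →
  (∀ k i → (κ (vertexAt k i) , index (vertexAt k i)) ≡ (k , i)) →
  (∀ p q → adj L p q ≡ κ p ~ κ q) → L ≅ BlowUp N
≅-blowUp-by-classes L κ index vertexAt vertexAt-index index-vertexAt adj-κ =
  mk↔ₛ′ (λ p → κ p , index p) (λ (k , i) → vertexAt k i) (λ (k , i) → index-vertexAt k i)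
    vertexAt-index ,
  λ p q → sym (adj-κ p q)

pairwise-by-enumeration : (vs : List V) → (∀ p → p ∈ vs) →
  {R : V → V → Set} (R? : ∀ p q → Dec (R p q)) →
  T (all (λ p → all (λ q → ⌊ R? p q ⌋) vs) vs) → ∀ p q → R p q
pairwise-by-enumeration vs complete R? ok p q = toWitness (allAt (allAt ok (complete p)) (complete q))

allX6 : List X6
allX6 = x0 ∷ x1 ∷ x2 ∷ x3 ∷ x4 ∷ x5 ∷ []

allX6-complete : ∀ p → p ∈ allX6
allX6-complete x0 = here refl
allX6-complete x1 = there (here refl)
allX6-complete x2 = there (there (here refl))
allX6-complete x3 = there (there (there (here refl)))
allX6-complete x4 = there (there (there (there (here refl))))
allX6-complete x5 = there (there (there (there (there (here refl)))))

allV7 : List V7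
allV7 = V7.r ∷ V7.s ∷ V7.t ∷ V7.u ∷ V7.v ∷ V7.w ∷ V7.x ∷ []

allV7-complete : ∀ p → p ∈ allV7
allV7-complete V7.r = here refl
allV7-complete V7.s = there (here refl)
allV7-complete V7.t = there (there (here refl))
allV7-complete V7.u = there (there (there (here refl)))
allV7-complete V7.v = there (there (there (there (here refl))))
allV7-complete V7.w = there (there (there (there (there (here refl)))))
allV7-complete V7.x = there (there (there (there (there (there (here refl))))))

familyCounts : Family → (Fin 9 → ℕ) → Class → ℕ
familyCounts f c = profile (familyProfile f c) (λ _ → 0)

c₆-≅ : (c : Fin 9 → ℕ) → C6 ≅ BlowUp (familyCounts c₆ c)
c₆-≅ c = ≅-blowUp-by-classes C6 class index vertexAt
  vertexAt-index index-vertexAt adj-class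
  where
  class : X6 → Class
  class x0 = frame 0F
  class x1 = frame 1F
  class x3 = frame 2F
  class x4 = frame 3F
  class x2 = type 3F
  class x5 = type 1F
  index : (p : X6) → Fin (familyCounts c₆ c (class p))
  index x0 = 0F
  index x1 = 0F
  index x3 = 0F
  index x4 = 0F
  index x2 = 0F
  index x5 = 0F
  vertexAt : ∀ k → Fin (familyCounts c₆ c k) → X6
  vertexAt (frame 0F) 0F = x0
  vertexAt (frame 1F) 0F = x1
  vertexAt (frame 2F) 0F = x3
  vertexAt (frame 3F) 0F = x4
  vertexAt (type 3F) 0F = x2
  vertexAt (type 1F) 0F = x5
  vertexAt (type 0F) ()
  vertexAt (type 2F) ()
  vertexAt (type 4F) ()
  vertexAt (type 5F) ()
  vertexAt (type 6F) ()
  vertexAt (type 7F) ()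
  vertexAt (type 8F) ()
  vertexAt (excluded _) ()
  vertexAt-index : ∀ p → vertexAt (class p) (index p) ≡ p
  vertexAt-index x0 = refl
  vertexAt-index x1 = refl
  vertexAt-index x3 = refl
  vertexAt-index x4 = refl
  vertexAt-index x2 = refl
  vertexAt-index x5 = refl
  index-vertexAt : ∀ k i → (class (vertexAt k i) , index (vertexAt k i)) ≡ (k , i)
  index-vertexAt (frame 0F) 0F = refl
  index-vertexAt (frame 1F) 0F = refl
  index-vertexAt (frame 2F) 0F = refl
  index-vertexAt (frame 3F) 0F = refl
  index-vertexAt (type 3F) 0F = refl
  index-vertexAt (type 1F) 0F = refl
  index-vertexAt (type 0F) ()
  index-vertexAt (type 2F) ()
  index-vertexAt (type 4F) ()
  index-vertexAt (type 5F) ()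
  index-vertexAt (type 6F) ()
  index-vertexAt (type 7F) ()
  index-vertexAt (type 8F) ()
  index-vertexAt (excluded _) ()
  adj-class : ∀ p q → adj C6 p q ≡ class p ~ class q
  adj-class = pairwise-by-enumeration allX6 allX6-complete
    (λ p q → adj C6 p q ≟ᵇ class p ~ class q) _

c₆+chord-≅ : (c : Fin 9 → ℕ) → C6+1 ≅ BlowUp (familyCounts c₆+chord c)
c₆+chord-≅ c = ≅-blowUp-by-classes C6+1 class index vertexAt
  vertexAt-index index-vertexAt adj-class
  where
  class : X6 → Class
  class x0 = frame 0F
  class x1 = frame 1F
  class x3 = frame 2F
  class x4 = frame 3F
  class x2 = type 6F
  class x5 = type 1F
  index : (p : X6) → Fin (familyCounts c₆+chord c (class p))
  index x0 = 0F
  index x1 = 0F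
  index x3 = 0F
  index x4 = 0F
  index x2 = 0F
  index x5 = 0F
  vertexAt : ∀ k → Fin (familyCounts c₆+chord c k) → X6
  vertexAt (frame 0F) 0F = x0
  vertexAt (frame 1F) 0F = x1
  vertexAt (frame 2F) 0F = x3
  vertexAt (frame 3F) 0F = x4
  vertexAt (type 6F) 0F = x2
  vertexAt (type 1F) 0F = x5
  vertexAt (type 0F) ()
  vertexAt (type 2F) ()
  vertexAt (type 3F) ()
  vertexAt (type 4F) ()
  vertexAt (type 5F) ()
  vertexAt (type 7F) ()
  vertexAt (type 8F) ()
  vertexAt (excluded _) ()
  vertexAt-index : ∀ p → vertexAt (class p) (index p) ≡ p
  vertexAt-index x0 = refl
  vertexAt-index x1 = refl
  vertexAt-index x3 = refl
  vertexAt-index x4 = refl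
  vertexAt-index x2 = refl
  vertexAt-index x5 = refl
  index-vertexAt : ∀ k i → (class (vertexAt k i) , index (vertexAt k i)) ≡ (k , i)
  index-vertexAt (frame 0F) 0F = refl
  index-vertexAt (frame 1F) 0F = refl
  index-vertexAt (frame 2F) 0F = refl
  index-vertexAt (frame 3F) 0F = refl
  index-vertexAt (type 6F) 0F = refl
  index-vertexAt (type 1F) 0F = refl
  index-vertexAt (type 0F) ()
  index-vertexAt (type 2F) ()
  index-vertexAt (type 3F) ()
  index-vertexAt (type 4F) ()
  index-vertexAt (type 5F) ()
  index-vertexAt (type 7F) ()
  index-vertexAt (type 8F) ()
  index-vertexAt (excluded _) ()
  adj-class : ∀ p q → adj C6+1 p q ≡ class p ~ class q
  adj-class = pairwise-by-enumeration allX6 allX6-complete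
    (λ p q → adj C6+1 p q ≟ᵇ class p ~ class q) _

c₆+chords-≅ : (c : Fin 9 → ℕ) → C6+2 ≅ BlowUp (familyCounts c₆+chords c)
c₆+chords-≅ c = ≅-blowUp-by-classes C6+2 class index vertexAt
  vertexAt-index index-vertexAt adj-class
  where
  class : X6 → Class
  class x0 = frame 0F
  class x1 = frame 1F
  class x3 = frame 2F
  class x4 = frame 3F
  class x2 = type 6F
  class x5 = type 2F
  index : (p : X6) → Fin (familyCounts c₆+chords c (class p))
  index x0 = 0F
  index x1 = 0F
  index x3 = 0F
  index x4 = 0F
  index x2 = 0F
  index x5 = 0F
  vertexAt : ∀ k → Fin (familyCounts c₆+chords c k) → X6
  vertexAt (frame 0F) 0F = x0
  vertexAt (frame 1F) 0F = x1
  vertexAt (frame 2F) 0F = x3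
  vertexAt (frame 3F) 0F = x4
  vertexAt (type 6F) 0F = x2
  vertexAt (type 2F) 0F = x5
  vertexAt (type 0F) ()
  vertexAt (type 1F) ()
  vertexAt (type 3F) ()
  vertexAt (type 4F) ()
  vertexAt (type 5F) ()
  vertexAt (type 7F) ()
  vertexAt (type 8F) ()
  vertexAt (excluded _) ()
  vertexAt-index : ∀ p → vertexAt (class p) (index p) ≡ p
  vertexAt-index x0 = refl
  vertexAt-index x1 = refl
  vertexAt-index x3 = refl
  vertexAt-index x4 = refl
  vertexAt-index x2 = refl
  vertexAt-index x5 = refl
  index-vertexAt : ∀ k i → (class (vertexAt k i) , index (vertexAt k i)) ≡ (k , i)
  index-vertexAt (frame 0F) 0F = refl
  index-vertexAt (frame 1F) 0F = refl
  index-vertexAt (frame 2F) 0F = refl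
  index-vertexAt (frame 3F) 0F = refl
  index-vertexAt (type 6F) 0F = refl
  index-vertexAt (type 2F) 0F = refl
  index-vertexAt (type 0F) ()
  index-vertexAt (type 1F) ()
  index-vertexAt (type 3F) ()
  index-vertexAt (type 4F) ()
  index-vertexAt (type 5F) ()
  index-vertexAt (type 7F) ()
  index-vertexAt (type 8F) ()
  index-vertexAt (excluded _) ()
  adj-class : ∀ p q → adj C6+2 p q ≡ class p ~ class q
  adj-class = pairwise-by-enumeration allX6 allX6-complete
    (λ p q → adj C6+2 p q ≟ᵇ class p ~ class q) _

g₄-≅ : (c : Fin 9 → ℕ) → G4 ≅ BlowUp (familyCounts g₄ c)
g₄-≅ c = ≅-blowUp-by-classes G4 class index vertexAt
  vertexAt-index index-vertexAt adj-class
  where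
  open V7
  class : V7 → Class
  class r = frame 0F
  class s = frame 1F
  class t = frame 2F
  class u = frame 3F
  class v = type 1F
  class w = type 0F
  class x = type 5F
  index : (p : V7) → Fin (familyCounts g₄ c (class p))
  index r = 0F
  index s = 0F
  index t = 0F
  index u = 0F
  index v = 0F
  index w = 0F
  index x = 0F
  vertexAt : ∀ k → Fin (familyCounts g₄ c k) → V7
  vertexAt (frame 0F) 0F = r
  vertexAt (frame 1F) 0F = s
  vertexAt (frame 2F) 0F = t
  vertexAt (frame 3F) 0F = u
  vertexAt (type 1F) 0F = v
  vertexAt (type 0F) 0F = w
  vertexAt (type 5F) 0F = x
  vertexAt (type 2F) ()
  vertexAt (type 3F) ()
  vertexAt (type 4F) ()
  vertexAt (type 6F) ()
  vertexAt (type 7F) ()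
  vertexAt (type 8F) ()
  vertexAt (excluded _) ()
  vertexAt-index : ∀ p → vertexAt (class p) (index p) ≡ p
  vertexAt-index r = refl
  vertexAt-index s = refl
  vertexAt-index t = refl
  vertexAt-index u = refl
  vertexAt-index v = refl
  vertexAt-index w = refl
  vertexAt-index x = refl
  index-vertexAt : ∀ k i → (class (vertexAt k i) , index (vertexAt k i)) ≡ (k , i)
  index-vertexAt (frame 0F) 0F = refl
  index-vertexAt (frame 1F) 0F = refl
  index-vertexAt (frame 2F) 0F = refl
  index-vertexAt (frame 3F) 0F = refl
  index-vertexAt (type 1F) 0F = refl
  index-vertexAt (type 0F) 0F = refl
  index-vertexAt (type 5F) 0F = refl
  index-vertexAt (type 2F) ()
  index-vertexAt (type 3F) ()
  index-vertexAt (type 4F) ()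
  index-vertexAt (type 6F) ()
  index-vertexAt (type 7F) ()
  index-vertexAt (type 8F) ()
  index-vertexAt (excluded _) ()
  adj-class : ∀ p q → adj G4 p q ≡ class p ~ class q
  adj-class = pairwise-by-enumeration allV7 allV7-complete
    (λ p q → adj G4 p q ≟ᵇ class p ~ class q) _

g₅-≅ : (c : Fin 9 → ℕ) → G5 (c 5F) (c 2F) (c 8F) ≅ BlowUp (familyCounts g₅ c)
g₅-≅ c = ≅-blowUp-by-classes (G5 (c 5F) (c 2F) (c 8F)) class index vertexAt
  vertexAt-index index-vertexAt adj-class
  where
  open V5
  class : V5 (c 5F) (c 2F) (c 8F) → Class
  class r = frame 0F
  class s = frame 1F
  class t = frame 2F
  class u = frame 3F
  class (W _) = type 5F
  class (X _) = type 2F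
  class (Y _) = type 8F
  index : (p : V5 (c 5F) (c 2F) (c 8F)) → Fin (familyCounts g₅ c (class p))
  index r = 0F
  index s = 0F
  index t = 0F
  index u = 0F
  index (W i) = i
  index (X i) = i
  index (Y i) = i
  vertexAt : ∀ k → Fin (familyCounts g₅ c k) → V5 (c 5F) (c 2F) (c 8F)
  vertexAt (frame 0F) 0F = r
  vertexAt (frame 1F) 0F = s
  vertexAt (frame 2F) 0F = t
  vertexAt (frame 3F) 0F = u
  vertexAt (type 5F) i = (W i)
  vertexAt (type 2F) i = (X i)
  vertexAt (type 8F) i = (Y i)
  vertexAt (type 0F) ()
  vertexAt (type 1F) ()
  vertexAt (type 3F) ()
  vertexAt (type 4F) ()
  vertexAt (type 6F) ()
  vertexAt (type 7F) ()
  vertexAt (excluded _) ()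
  vertexAt-index : ∀ p → vertexAt (class p) (index p) ≡ p
  vertexAt-index r = refl
  vertexAt-index s = refl
  vertexAt-index t = refl
  vertexAt-index u = refl
  vertexAt-index (W _) = refl
  vertexAt-index (X _) = refl
  vertexAt-index (Y _) = refl
  index-vertexAt : ∀ k i → (class (vertexAt k i) , index (vertexAt k i)) ≡ (k , i)
  index-vertexAt (frame 0F) 0F = refl
  index-vertexAt (frame 1F) 0F = refl
  index-vertexAt (frame 2F) 0F = refl
  index-vertexAt (frame 3F) 0F = refl
  index-vertexAt (type 5F) i = refl
  index-vertexAt (type 2F) i = refl
  index-vertexAt (type 8F) i = refl
  index-vertexAt (type 0F) ()
  index-vertexAt (type 1F) ()
  index-vertexAt (type 3F) ()
  index-vertexAt (type 4F) ()
  index-vertexAt (type 6F) ()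
  index-vertexAt (type 7F) ()
  index-vertexAt (excluded _) ()
  adj-class : ∀ p q → adj (G5 (c 5F) (c 2F) (c 8F)) p q ≡ class p ~ class q
  adj-class = λ
    { r r → refl ; r s → refl ; r t → refl ; r u → refl
      ; r (W _) → refl ; r (X _) → refl ; r (Y _) → refl
    ; s r → refl ; s s → refl ; s t → refl ; s u → refl
      ; s (W _) → refl ; s (X _) → refl ; s (Y _) → refl
    ; t r → refl ; t s → refl ; t t → refl ; t u → refl
      ; t (W _) → refl ; t (X _) → refl ; t (Y _) → refl
    ; u r → refl ; u s → refl ; u t → refl ; u u → refl
      ; u (W _) → refl ; u (X _) → refl ; u (Y _) → refl
    ; (W _) r → refl ; (W _) s → refl ; (W _) t → refl ; (W _) u → refl
      ; (W _) (W _) → refl ; (W _) (X _) → refl ; (W _) (Y _) → refl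
    ; (X _) r → refl ; (X _) s → refl ; (X _) t → refl ; (X _) u → refl
      ; (X _) (W _) → refl ; (X _) (X _) → refl ; (X _) (Y _) → refl
    ; (Y _) r → refl ; (Y _) s → refl ; (Y _) t → refl ; (Y _) u → refl
      ; (Y _) (W _) → refl ; (Y _) (X _) → refl ; (Y _) (Y _) → refl
    }

g₆-≅ : (c : Fin 9 → ℕ) → G6 (c 3F) (c 4F) (c 5F) (c 8F) ≅ BlowUp (familyCounts g₆ c)
g₆-≅ c = ≅-blowUp-by-classes (G6 (c 3F) (c 4F) (c 5F) (c 8F)) class index vertexAt
  vertexAt-index index-vertexAt adj-class
  where
  open V6
  class : V6 (c 3F) (c 4F) (c 5F) (c 8F) → Class
  class r = frame 0F
  class s = frame 1F
  class t = frame 2F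
  class u = frame 3F
  class (W _) = type 3F
  class (X _) = type 4F
  class (Y _) = type 5F
  class (Z _) = type 8F
  index : (p : V6 (c 3F) (c 4F) (c 5F) (c 8F)) → Fin (familyCounts g₆ c (class p))
  index r = 0F
  index s = 0F
  index t = 0F
  index u = 0F
  index (W i) = i
  index (X i) = i
  index (Y i) = i
  index (Z i) = i
  vertexAt : ∀ k → Fin (familyCounts g₆ c k) → V6 (c 3F) (c 4F) (c 5F) (c 8F)
  vertexAt (frame 0F) 0F = r
  vertexAt (frame 1F) 0F = s
  vertexAt (frame 2F) 0F = t
  vertexAt (frame 3F) 0F = u
  vertexAt (type 3F) i = (W i)
  vertexAt (type 4F) i = (X i)
  vertexAt (type 5F) i = (Y i)
  vertexAt (type 8F) i = (Z i)
  vertexAt (type 0F) ()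
  vertexAt (type 1F) ()
  vertexAt (type 2F) ()
  vertexAt (type 6F) ()
  vertexAt (type 7F) ()
  vertexAt (excluded _) ()
  vertexAt-index : ∀ p → vertexAt (class p) (index p) ≡ p
  vertexAt-index r = refl
  vertexAt-index s = refl
  vertexAt-index t = refl
  vertexAt-index u = refl
  vertexAt-index (W _) = refl
  vertexAt-index (X _) = refl
  vertexAt-index (Y _) = refl
  vertexAt-index (Z _) = refl
  index-vertexAt : ∀ k i → (class (vertexAt k i) , index (vertexAt k i)) ≡ (k , i)
  index-vertexAt (frame 0F) 0F = refl
  index-vertexAt (frame 1F) 0F = refl
  index-vertexAt (frame 2F) 0F = refl
  index-vertexAt (frame 3F) 0F = refl
  index-vertexAt (type 3F) i = refl
  index-vertexAt (type 4F) i = refl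
  index-vertexAt (type 5F) i = refl
  index-vertexAt (type 8F) i = refl
  index-vertexAt (type 0F) ()
  index-vertexAt (type 1F) ()
  index-vertexAt (type 2F) ()
  index-vertexAt (type 6F) ()
  index-vertexAt (type 7F) ()
  index-vertexAt (excluded _) ()
  adj-class : ∀ p q → adj (G6 (c 3F) (c 4F) (c 5F) (c 8F)) p q ≡ class p ~ class q
  adj-class = λ
    { r r → refl ; r s → refl ; r t → refl ; r u → refl
      ; r (W _) → refl ; r (X _) → refl ; r (Y _) → refl ; r (Z _) → refl
    ; s r → refl ; s s → refl ; s t → refl ; s u → refl
      ; s (W _) → refl ; s (X _) → refl ; s (Y _) → refl ; s (Z _) → refl
    ; t r → refl ; t s → refl ; t t → refl ; t u → refl
      ; t (W _) → refl ; t (X _) → refl ; t (Y _) → refl ; t (Z _) → refl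
    ; u r → refl ; u s → refl ; u t → refl ; u u → refl
      ; u (W _) → refl ; u (X _) → refl ; u (Y _) → refl ; u (Z _) → refl
    ; (W _) r → refl ; (W _) s → refl ; (W _) t → refl ; (W _) u → refl
      ; (W _) (W _) → refl ; (W _) (X _) → refl ; (W _) (Y _) → refl ; (W _) (Z _) → refl
    ; (X _) r → refl ; (X _) s → refl ; (X _) t → refl ; (X _) u → refl
      ; (X _) (W _) → refl ; (X _) (X _) → refl ; (X _) (Y _) → refl ; (X _) (Z _) → refl
    ; (Y _) r → refl ; (Y _) s → refl ; (Y _) t → refl ; (Y _) u → refl
      ; (Y _) (W _) → refl ; (Y _) (X _) → refl ; (Y _) (Y _) → refl ; (Y _) (Z _) → refl
    ; (Z _) r → refl ; (Z _) s → refl ; (Z _) t → refl ; (Z _) u → refl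
      ; (Z _) (W _) → refl ; (Z _) (X _) → refl ; (Z _) (Y _) → refl ; (Z _) (Z _) → refl
    }

present : Multiplicity → Bool
present absent = false
present single = true
present several = true

singletonMultiplicity : Multiplicity → Bool
singletonMultiplicity several = false
singletonMultiplicity _ = true

module FamilyCriticality (f : Family) where

  shape : Fin 9 → Multiplicity
  shape = lookup (familyShape f)

  classes : List Class
  classes = List.map frame (allFin 4) ++ List.map type (filter (T? ∘ present ∘ shape) (allFin 9))

  singleton : Class → Bool
  singleton (type i) = singletonMultiplicity (shape i)
  singleton _ = true

  module _ (c : Fin 9 → ℕ) where

    occurring : ∀ k → Fin (familyCounts f c k) → k ∈ classes
    occurring (frame j) _ = ∈-++⁺ˡ (∈-map⁺ frame (∈-allFin j))
    occurring (type i) x =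
      ∈-++⁺ʳ _ (∈-map⁺ type (∈-filter⁺ (T? ∘ present ∘ shape) (∈-allFin i)
        (copy-present (shape i) x)))
      where
      copy-present : ∀ μ → Fin (copies μ (c i)) → T (present μ)
      copy-present single _ = _
      copy-present several _ = _
    occurring (excluded _) ()

    unique : ∀ k → T (singleton k) → (i j : Fin (familyCounts f c k)) → i ≡ j
    unique (frame _) _ 0F 0F = refl
    unique (type i) = unique-copies (shape i)
      where
      unique-copies : ∀ μ → T (singletonMultiplicity μ) →
        (x y : Fin (copies μ (c i))) → x ≡ y
      unique-copies single _ 0F 0F = refl
    unique (excluded _) _ ()

familyNoWitness : ∀ f →
  let open FamilyCriticality f in ClassCheck.noWitness singleton classes ≡ true
familyNoWitness c₆ = refl
familyNoWitness c₆+chord = refl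
familyNoWitness c₆+chords = refl
familyNoWitness g₄ = refl
familyNoWitness g₅ = refl
familyNoWitness g₆ = refl

familyCounts-critical : ∀ f c →
  Has2K2-adj (BlowUp (familyCounts f c)) × NoContracted2K2 (BlowUp (familyCounts f c))
familyCounts-critical f c =
  (fr 0F , fr 1F , fr 2F , fr 3F , refl , refl , refl , refl , refl , refl) ,
  ClassCheck.Sound.noContracted2K2 singleton classes (occurring c) (unique c)
    (Equivalence.from T-≡ (familyNoWitness f))
  where open FamilyCriticality f

-- Critical graphs are in the list

module _ {n : ℕ} {G : FinGraph n} where

  configOf : Frame G → Configuration
  configOf F = tabulate (level ∘ FrameClasses.typeCount F)

  reframeIf : Bool → FrameSymmetry → Frame G → Frame G
  reframeIf false σ F = F
  reframeIf true σ F = Reframe.reframed F σ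

  reorient : Bool → Bool → Bool → Frame G → Frame G
  reorient b₁ b₂ b₃ = reframeIf b₃ swapEdges ∘ reframeIf b₂ swapTU ∘ reframeIf b₁ swapRS

  applyIf-configOf : ∀ b σ F → applyIf b σ (configOf F) ≡ configOf (reframeIf b σ F)
  applyIf-configOf false σ F = refl
  applyIf-configOf true σ F = tabulate-cong λ i →
    trans (lookup∘tabulate (level ∘ FrameClasses.typeCount F) (FrameSymmetry.onTypes σ i))
          (cong level (sym (Reframe.typeCount-reframed F σ i)))

  orient-configOf : ∀ b₁ b₂ b₃ F → orient b₁ b₂ b₃ (configOf F) ≡ configOf (reorient b₁ b₂ b₃ F)
  orient-configOf b₁ b₂ b₃ F = begin
    applyIf b₃ swapEdges (applyIf b₂ swapTU (applyIf b₁ swapRS (configOf F)))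
      ≡⟨ cong (applyIf b₃ swapEdges ∘ applyIf b₂ swapTU) (applyIf-configOf b₁ swapRS F) ⟩
    applyIf b₃ swapEdges (applyIf b₂ swapTU (configOf F₁))
      ≡⟨ cong (applyIf b₃ swapEdges) (applyIf-configOf b₂ swapTU F₁) ⟩
    applyIf b₃ swapEdges (configOf F₂)
      ≡⟨ applyIf-configOf b₃ swapEdges F₂ ⟩
    configOf (reframeIf b₃ swapEdges F₂) ∎
    where
    open ≡-Reasoning
    F₁ = reframeIf b₁ swapRS F
    F₂ = reframeIf b₂ swapTU F₁

module FrameAnalysis {n : ℕ} {G : FinGraph n} (noIsolated : NoIsolated G)
  (none : NoContracted2K2 G) (F : Frame G) where
  open FrameClasses F

  private
    H = BlowUp (profile typeCount excludedCount)

  blowUp-noContracted2K2 : NoContracted2K2 H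
  blowUp-noContracted2K2 =
    noContracted2K2-hereditary
      (≅⇒embedding {G = H} {H = G} (≅-sym {G = G} {H = H} ≅-blowUp-profile)) none

  excludedCount-zero : ∀ j → excludedCount j ≡ 0
  excludedCount-zero 0F = isolatedClass-empty (noIsolated-≅ {G = G} {H = H} ≅-blowUp-profile noIsolated)
  excludedCount-zero (suc j) = sideCopies-absent blowUp-noContracted2K2 j

  typeCopies-≤ : ∀ O → T (contains (configOf F) O) →
    ∀ i → lookup (TypeObstruction.copies O) i ≤ typeCount i
  typeCopies-≤ O containsO i = ≤-trans
    (≤ᵇ⇒≤ _ _ (allZip-sound (λ m l → m ≤ᵇ toℕ l) (TypeObstruction.copies O) (configOf F) containsO i))
    (subst (λ l → toℕ l ≤ typeCount i) (sym (lookup∘tabulate (level ∘ typeCount) i))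
      (level-≤ (typeCount i)))

  unobstructed : ¬ T (any (contains (configOf F)) typeObstructions)
  unobstructed contained = obstructed (proj₁ valid×contained) (proj₂ valid×contained)
    where
    occurrence = any⁻ (contains (configOf F)) typeObstructions contained
    O = TypeObstruction.asObstruction (Any.lookup occurrence)
    valid×contained = All.lookupAny
      (all⁺ (Obstruction.valid ∘ TypeObstruction.asObstruction) typeObstructions typeObstructions-valid)
      occurrence
    obstructed : T (Obstruction.valid O) → T (contains (configOf F) (Any.lookup occurrence)) → ⊥
    obstructed valid containsO = obstruction-absent blowUp-noContracted2K2 O valid
      (typeCopies-≤ (Any.lookup occurrence) containsO)
      (λ j → subst (_≤ excludedCount j) (sym (lookup-replicate j 0)) z≤n)

  configOf-identified : identified (configOf F) ≡ true
  configOf-identified = resolve (λ contained → unobstructed (Equivalence.from T-≡ contained))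
    (checkAll-sound 9 classified all-classified (configOf F))
    where
    resolve : ∀ {x y} → x ≢ true → x ∨ y ≡ true → y ≡ true
    resolve {true} x≢true _ = ⊥-elim (x≢true refl)
    resolve {false} _ y≡true = y≡true

  matches-typeCount : ∀ {f} → matches f (configOf F) ≡ true →
    ∀ i → typeCount i ≡ familyProfile f typeCount i
  matches-typeCount {f} ok i = fits-level (lookup (familyShape f) i) (typeCount i)
    (subst (T ∘ fits (lookup (familyShape f) i)) (lookup∘tabulate (level ∘ typeCount) i)
      (allZip-sound fits (familyShape f) (configOf F) (Equivalence.from T-≡ ok) i))

  ≅-family : ∀ {f} → matches f (configOf F) ≡ true → G ≅ BlowUp (familyCounts f typeCount)
  ≅-family {f} ok =
    ≅-trans {G = G} {H = H} {K = BlowUp (familyCounts f typeCount)} ≅-blowUp-profile (blowUp-cong counts)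
    where
    counts : ∀ k → profile typeCount excludedCount k ≡ familyCounts f typeCount k
    counts (frame _) = refl
    counts (type i) = matches-typeCount {f} ok i
    counts (excluded j) = excludedCount-zero j

module _ {G : Graph V} where

  ≅-via : (L : Graph U) (N : Class → ℕ) → G ≅ BlowUp N → L ≅ BlowUp N → G ≅ L
  ≅-via L N g l = ≅-trans {G = G} {H = BlowUp N} {K = L} g (≅-sym {G = L} {H = BlowUp N} l)

  inList : ∀ f c → G ≅ BlowUp (familyCounts f c) → InList G
  inList c₆ c iso = inj₁ (≅-via C6 (familyCounts c₆ c) iso (c₆-≅ c))
  inList c₆+chord c iso = inj₂ (inj₁ (≅-via C6+1 (familyCounts c₆+chord c) iso (c₆+chord-≅ c)))
  inList c₆+chords c iso = inj₂ (inj₂ (inj₁ (≅-via C6+2 (familyCounts c₆+chords c) iso (c₆+chords-≅ c))))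
  inList g₄ c iso = inj₂ (inj₂ (inj₂ (inj₁ (≅-via G4 (familyCounts g₄ c) iso (g₄-≅ c)))))
  inList g₅ c iso = inj₂ (inj₂ (inj₂ (inj₂ (inj₁ (c 5F , c 2F , c 8F ,
    ≅-via (G5 (c 5F) (c 2F) (c 8F)) (familyCounts g₅ c) iso (g₅-≅ c))))))
  inList g₆ c iso = inj₂ (inj₂ (inj₂ (inj₂ (inj₂ (c 3F , c 4F , c 5F , c 8F ,
    ≅-via (G6 (c 3F) (c 4F) (c 5F) (c 8F)) (familyCounts g₆ c) iso (g₆-≅ c))))))

  critical-via : (L : Graph U) (f : Family) (c : Fin 9 → ℕ) →
    G ≅ L → L ≅ BlowUp (familyCounts f c) → Has2K2-adj G × NoContracted2K2 G
  critical-via L f c g l = critical-≅ {G = G} {H = BlowUp (familyCounts f c)}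
    (≅-trans {G = G} {H = L} {K = BlowUp (familyCounts f c)} g l) (familyCounts-critical f c)

  inList⇒critical : InList G → Has2K2-adj G × NoContracted2K2 G
  inList⇒critical (inj₁ iso) = critical-via C6 c₆ (λ _ → 0) iso (c₆-≅ _)
  inList⇒critical (inj₂ (inj₁ iso)) = critical-via C6+1 c₆+chord (λ _ → 0) iso (c₆+chord-≅ _)
  inList⇒critical (inj₂ (inj₂ (inj₁ iso))) = critical-via C6+2 c₆+chords (λ _ → 0) iso (c₆+chords-≅ _)
  inList⇒critical (inj₂ (inj₂ (inj₂ (inj₁ iso)))) = critical-via G4 g₄ (λ _ → 0) iso (g₄-≅ _)
  inList⇒critical (inj₂ (inj₂ (inj₂ (inj₂ (inj₁ (a , b , c , iso)))))) =
    critical-via (G5 a b c) g₅ (lookup (0 ∷ 0 ∷ b ∷ 0 ∷ 0 ∷ a ∷ 0 ∷ 0 ∷ c ∷ [])) iso (g₅-≅ _)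
  inList⇒critical (inj₂ (inj₂ (inj₂ (inj₂ (inj₂ (a , b , c , d , iso)))))) =
    critical-via (G6 a b c d) g₆ (lookup (0 ∷ 0 ∷ 0 ∷ a ∷ b ∷ c ∷ 0 ∷ 0 ∷ d ∷ [])) iso (g₆-≅ _)

critical⇒inList : ∀ {n} (G : FinGraph n) → NoIsolated G → Has2K2-adj G → NoContracted2K2 G → InList G
critical⇒inList G noIsolated h none =
  fromWitness (identified-witness {configOf F} (FrameAnalysis.configOf-identified noIsolated none F))
  where
  F : Frame G
  F = frameOf2K2 none h
  fromWitness : (Σ Orientation λ (b₁ , b₂ , b₃) → Σ Family λ f →
                  matches f (orient b₁ b₂ b₃ (configOf F)) ≡ true) → InList G
  fromWitness ((b₁ , b₂ , b₃) , f , matching) =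
    inList {G = G} f (FrameClasses.typeCount F′) (FrameAnalysis.≅-family noIsolated none F′ {f}
      (trans (cong (matches f) (sym (orient-configOf b₁ b₂ b₃ F))) matching))
    where
    F′ = reorient b₁ b₂ b₃ F

proposition24 : (n : ℕ) (G : FinGraph n) → NoIsolated G →
    (Critically2K2Exist G ⇔ InList G)
proposition24 n G noIsolated = mk⇔
  (λ critical → let h , none = Equivalence.to (critically2K2Exist⇔ G) critical in
                critical⇒inList G noIsolated h none)
  (λ listed → Equivalence.from (critically2K2Exist⇔ G) (inList⇒critical listed))
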